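{- Let $q\not\equiv0\pmod3$, $\mu\in\mathbb{F}_q$, and let $\ell_\mu$ be the line through $\mathrm{P}(0,\mu,0,1)$ and $\mathrm{P}(1,0,1,0)$. Then: (i) $\ell_\mu$ is an imaginary axis if and only if $q$ is odd, $q\equiv-1\pmod3$, and $\mu=1/9$; (ii) $\ell_\mu$ is a real axis if and only if $q$ is odd, $q\equiv1\pmod3$, and $\mu=1/9$.
   Context: $\mathrm{P}(x_0,x_1,x_2,x_3)$ denotes a point of $\mathrm{PG}(3,q)$ in homogeneous coordinates. For $t$ in $\mathbb{F}_q$ or $\mathbb{F}_{q^2}$, the osculating plane of the twisted cubic $\{\mathrm{P}(t^3,t^2,t,1)\}\cup\{\mathrm{P}(1,0,0,0)\}$ at parameter $t$ is $\pi(t): x_0-3tx_1+3t^2x_2-t^3x_3=0$, and $\pi(\infty): x_3=0$. A real axis is a line $\pi(t_1)\cap\pi(t_2)$ with $t_1\neq t_2$ in $\mathbb{F}_q\cup\{\infty\}$; an imaginary axis is a line $\pi(t)\cap\pi(t^q)$ with $t\in\mathbb{F}_{q^2}\setminus\mathbb{F}_q$ (this is a line of $\mathrm{PG}(3,q)$). -}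

module Defs where

open import Level using (0ℓ)
open import Data.Nat as ℕ using (ℕ; zero; suc)
open import Data.Fin using (Fin)
open import Data.Maybe using (Maybe; just; nothing)
open import Data.Product using (Σ; ∃; ∃-syntax; _×_; _,_)
open import Relation.Nullary using (¬_)
open import Relation.Binary.PropositionalEquality as ≡ using (_≡_)
open import Function.Bundles using (Inverse)
open import Algebra.Bundles using (CommutativeRing)
open import Algebra.Morphism.Structures using (IsRingHomomorphism)

record FiniteField (q : ℕ) : Set₁ where
  field
    cring : CommutativeRing 0ℓ 0ℓ
  open CommutativeRing cring public
  field
    1≉0     : ¬ (1# ≈ 0#)
    inverse : ∀ x → ¬ (x ≈ 0#) → ∃[ y ] (x * y ≈ 1#)
    card    : Inverse (≡.setoid (Fin q)) setoid

  fromℕ : ℕ → Carrier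
  fromℕ zero    = 0#
  fromℕ (suc n) = 1# + fromℕ n

  _^_ : Carrier → ℕ → Carrier
  x ^ zero  = 1#
  x ^ suc n = x * (x ^ n)

  -- points of PG(3,q) are represented by nonzero vectors of F^4
  record Vec4 : Set where
    eta-equality
    constructor v4
    field
      c0 c1 c2 c3 : Carrier

  NonZero4 : Vec4 → Set
  NonZero4 (v4 a b c d) = ¬ (a ≈ 0# × b ≈ 0# × c ≈ 0# × d ≈ 0#)

  -- x lies on the osculating plane π(t) (t = nothing means t = ∞)
  OnOsc : Maybe Carrier → Vec4 → Set
  OnOsc (just t) (v4 x0 x1 x2 x3) =
    (x0 - fromℕ 3 * t * x1 + fromℕ 3 * (t ^ 2) * x2) - (t ^ 3) * x3 ≈ 0#
  OnOsc nothing  (v4 x0 x1 x2 x3) = x3 ≈ 0#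

record QuadExt {q : ℕ} (F : FiniteField q) : Set₁ where
  field
    E : FiniteField (q ℕ.* q)
  module F = FiniteField F
  module E = FiniteField E
  field
    ι      : F.Carrier → E.Carrier
    ι-hom  : IsRingHomomorphism (CommutativeRing.rawRing F.cring)
                                (CommutativeRing.rawRing E.cring) ι
    ι-inj  : ∀ x y → ι x E.≈ ι y → x F.≈ y

  embed : F.Vec4 → E.Vec4
  embed (F.v4 a b c d) = E.v4 (ι a) (ι b) (ι c) (ι d)

module _ {q : ℕ} (F : FiniteField q) where
  open FiniteField F

  InSpan : Vec4 → Vec4 → Vec4 → Set
  InSpan (v4 u0 u1 u2 u3) (v4 w0 w1 w2 w3) (v4 x0 x1 x2 x3) =
    ∃[ a ] ∃[ b ] (x0 ≈ a * u0 + b * w0 × x1 ≈ a * u1 + b * w1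
                 × x2 ≈ a * u2 + b * w2 × x3 ≈ a * u3 + b * w3)

  OnLineμ : Carrier → Vec4 → Set
  OnLineμ μ = InSpan (v4 0# μ 0# 1#) (v4 1# 0# 1# 0#)

  DistinctParam : Maybe Carrier → Maybe Carrier → Set
  DistinctParam (just s) (just t) = ¬ (s ≈ t)
  DistinctParam (just _) nothing  = Data.Unit.⊤ where import Data.Unit
  DistinctParam nothing  (just _) = Data.Unit.⊤ where import Data.Unit
  DistinctParam nothing  nothing  = Data.Empty.⊥ where import Data.Empty

  IsRealAxis : Carrier → Set
  IsRealAxis μ = ∃[ t1 ] ∃[ t2 ] (DistinctParam t1 t2 ×
    (∀ x → NonZero4 x → (OnLineμ μ x → OnOsc t1 x × OnOsc t2 x)
                       × (OnOsc t1 x × OnOsc t2 x → OnLineμ μ x)))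

IsImaginaryAxis : ∀ {q} {F : FiniteField q} → QuadExt F → FiniteField.Carrier F → Set
IsImaginaryAxis {q} {F} K μ =
  ∃[ t ] ((∀ s → ¬ (ι s E.≈ t)) ×
    (∀ x → F.NonZero4 x →
       (OnLineμ F μ x → E.OnOsc (just t) (embed x) × E.OnOsc (just (t E.^ q)) (embed x))
     × (E.OnOsc (just t) (embed x) × E.OnOsc (just (t E.^ q)) (embed x) → OnLineμ F μ x)))
  where open QuadExt K

{-# OPTIONS --safe #-}
module Submission where

-- ℓ_μ is spanned by P₀ = P(0,μ,0,1) and P₁ = P(1,0,1,0), so π(t) ⊇ ℓ_μ exactly when
-- 3t² + 1 = 0 and 3μ + t² = 0, that is, when (3t)² = -3 and 9μ = 1.  When 2 and 3 are
-- invertible, the planes π(t) and π(-t) then meet exactly in ℓ_μ, and for t ∉ F_q every point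
-- of PG(3,q) on π(t) already lies on ℓ_μ.  So ℓ_μ is a real axis iff 9μ = 1, q is odd and -3 is
-- a square in F_q, and an imaginary axis iff 9μ = 1, q is odd and -3 is a non-square: then
-- t = 3μ√-3 lies in F_{q²} \ F_q, and t^q = ±t since t² ∈ F_q.  (In characteristic 2 the only
-- candidate is t = 1.)
--
-- The arithmetic conditions come from counting fixed points: a permutation of order 2 or 3 of
-- a finite set of size N fixes N points modulo 2 or 3.  Hence q is odd iff 2 ≠ 0 (use x ↦ -x
-- and x ↦ x + 1).  A root ω of x² - x + 1, equivalently a square root 2ω - 1 of -3, gives
-- q ≡ 1 (mod 3) through x ↦ -ωx; conversely, for q ≡ 1 (mod 3) the Möbius map x ↦ 1/(1 - x),
-- of order three on the q + 1 points of the projective line, has a fixed point, and its fixed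
-- points are the roots of x² - x + 1.

open import Defs
open import Data.Nat as ℕ using (ℕ; zero; suc; _%_; _<_)
import Data.Nat.Properties as ℕ
open import Data.Nat.DivMod using (%-distribˡ-+; %-distribˡ-*)
open import Data.Integer as ℤ using (ℤ; +_; -[1+_])
import Data.Integer.Properties as ℤ
open import Data.Sign as Sign using (Sign)
open import Data.Fin as Fin using (Fin)
open import Data.Fin.Properties using (suc-injective; 0≢1+n)
open import Data.Fin.Permutation using (permutation)
open import Data.Maybe using (Maybe; just; nothing)
open import Data.Product using (∃-syntax; _×_; _,_; proj₁; proj₂)
open import Data.Sum as Sum using (_⊎_; inj₁; inj₂; [_,_]′)
open import Function.Base using (id)
open import Data.Empty using (⊥-elim)
open import Function.Bundles using (Inverse; _⇔_; mk⇔)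
open import Relation.Nullary using (¬_; Dec; yes; no)
open import Relation.Binary using (_Preserves_⟶_)
open import Relation.Binary.PropositionalEquality as ≡ using (_≡_; _≢_)
open import Algebra.Morphism.Structures using (IsRingHomomorphism)
import Algebra.Properties.CommutativeMonoid.Sum
import Algebra.Solver.Ring
open import Algebra.Solver.Ring.AlmostCommutativeRing using (_-Raw-AlmostCommutative⟶_; fromCommutativeRing)

module Counting where

  open import Data.Nat using (_+_; _*_; _<?_)
  open import Data.Nat.DivMod using ([m+kn]%n≡m%n; m%n<n)
  open import Data.Fin using (toℕ)
  open import Data.Fin.Properties using (toℕ-injective)
  open import Relation.Nullary.Decidable using (_×-dec_)
  open import Relation.Unary using (Pred; Decidable)
  open import Relation.Binary using (tri<; tri≈; tri>)
  open import Algebra.Properties.CommutativeMonoid.Sum ℕ.+-0-commutativeMonoid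
    using (sum; sum-cong-≗; sum-permute; ∑-distrib-+)
  open ≡ using (refl; sym; trans; cong; cong₂; subst; module ≡-Reasoning)

  indicator : ∀ {P : Set} → Dec P → ℕ
  indicator (yes _) = 1
  indicator (no _)  = 0

  indicator-yes : ∀ {P : Set} (P? : Dec P) → P → indicator P? ≡ 1
  indicator-yes (yes _) _ = refl
  indicator-yes (no ¬p) p = ⊥-elim (¬p p)

  indicator-no : ∀ {P : Set} (P? : Dec P) → ¬ P → indicator P? ≡ 0
  indicator-no (yes p) ¬p = ⊥-elim (¬p p)
  indicator-no (no _)  _  = refl

  count : ∀ {N} {P : Pred (Fin N) _} → Decidable P → ℕ
  count P? = sum (λ i → indicator (P? i))

  count-none : ∀ {N} {P : Pred (Fin N) _} (P? : Decidable P) → (∀ i → ¬ P i) → count P? ≡ 0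
  count-none {zero}  P? ¬P = refl
  count-none {suc N} P? ¬P =
    cong₂ _+_ (indicator-no (P? Fin.zero) (¬P _)) (count-none (λ i → P? (Fin.suc i)) (λ i → ¬P _))

  count-unique : ∀ {N} {P : Pred (Fin N) _} (P? : Decidable P) a → P a → (∀ i → P i → i ≡ a) →
                 count P? ≡ 1
  count-unique {suc N} P? Fin.zero pa unique =
    cong₂ _+_ (indicator-yes (P? Fin.zero) pa)
              (count-none (λ i → P? (Fin.suc i)) (λ i p → 0≢1+n (sym (unique _ p))))
  count-unique {suc N} P? (Fin.suc a) pa unique =
    cong₂ _+_ (indicator-no (P? Fin.zero) (λ p → 0≢1+n (unique _ p)))
              (count-unique (λ i → P? (Fin.suc i)) a pa (λ i p → suc-injective (unique _ p)))

  count≢0⇒∃ : ∀ {N} {P : Pred (Fin N) _} (P? : Decidable P) → ¬ count P? ≡ 0 → ∃[ i ] P i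
  count≢0⇒∃ {zero}  P? c≢0 = ⊥-elim (c≢0 refl)
  count≢0⇒∃ {suc N} P? c≢0 with P? Fin.zero
  ... | yes p = Fin.zero , p
  ... | no _  with count≢0⇒∃ (λ i → P? (Fin.suc i)) c≢0
  ...   | i , p = Fin.suc i , p

  sum-const-1 : ∀ N → sum {N} (λ _ → 1) ≡ N
  sum-const-1 zero    = refl
  sum-const-1 (suc N) = cong suc (sum-const-1 N)

  sum-∘-bijection : ∀ {N} (f : Fin N → ℕ) (σ τ : Fin N → Fin N) →
                    (∀ i → σ (τ i) ≡ i) → (∀ i → τ (σ i) ≡ i) → sum (λ i → f (σ i)) ≡ sum f
  sum-∘-bijection f σ τ στ τσ = sym (sum-permute f (permutation σ τ στ τσ))

  m≡n+p*k⇒m%p≡n%p : ∀ {m} n p k .{{_ : ℕ.NonZero p}} → m ≡ n + p * k → m % p ≡ n % p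
  m≡n+p*k⇒m%p≡n%p n p k refl = trans (cong (λ r → (n + r) % p) (ℕ.*-comm p k)) ([m+kn]%n≡m%n n k p)

  n%3≢0,1⇒≡2 : ∀ n → n % 3 ≢ 0 → n % 3 ≢ 1 → n % 3 ≡ 2
  n%3≢0,1⇒≡2 n ≢0 ≢1 = cases (n % 3) (m%n<n n 3) ≢0 ≢1
    where
    cases : ∀ r → r < 3 → r ≢ 0 → r ≢ 1 → r ≡ 2
    cases 0 _ ≢0 _ = ⊥-elim (≢0 refl)
    cases 1 _ _ ≢1 = ⊥-elim (≢1 refl)
    cases 2 _ _ _  = refl
    cases (suc (suc (suc _))) (ℕ.s≤s (ℕ.s≤s (ℕ.s≤s ()))) _ _

  isLeast : ℕ → ℕ → ℕ → ℕ
  isLeast a b c = indicator ((a <? b) ×-dec (a <? c))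

  isLeast-≡ : ∀ {a b} c → a ≡ b → isLeast a b c ≡ 0
  isLeast-≡ {a} {b} c a≡b = indicator-no ((a <? b) ×-dec (a <? c)) (λ (a<b , _) → ℕ.<-irrefl a≡b a<b)

  isLeast-distinct : ∀ a b c → ¬ a ≡ b → ¬ b ≡ c → ¬ a ≡ c →
                   isLeast a b c + isLeast b c a + isLeast c a b ≡ 1
  isLeast-distinct a b c a≢b b≢c a≢c with ℕ.<-cmp a b | ℕ.<-cmp b c | ℕ.<-cmp a c
  ... | tri≈ _ a≡b _ | _ | _ = ⊥-elim (a≢b a≡b)
  ... | _ | tri≈ _ b≡c _ | _ = ⊥-elim (b≢c b≡c)
  ... | _ | _ | tri≈ _ a≡c _ = ⊥-elim (a≢c a≡c)
  ... | tri< a<b _ _ | _ | tri< a<c _ _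
    rewrite indicator-yes ((a <? b) ×-dec (a <? c)) (a<b , a<c)
          | indicator-no ((b <? c) ×-dec (b <? a)) (λ (_ , b<a) → ℕ.<-asym a<b b<a)
          | indicator-no ((c <? a) ×-dec (c <? b)) (λ (c<a , _) → ℕ.<-asym a<c c<a) = refl
  ... | tri< a<b _ _ | _ | tri> _ _ c<a
    rewrite indicator-no ((a <? b) ×-dec (a <? c)) (λ (_ , a<c) → ℕ.<-asym a<c c<a)
          | indicator-no ((b <? c) ×-dec (b <? a)) (λ (_ , b<a) → ℕ.<-asym a<b b<a)
          | indicator-yes ((c <? a) ×-dec (c <? b)) (c<a , ℕ.<-trans c<a a<b) = refl
  ... | tri> _ _ b<a | tri< b<c _ _ | _
    rewrite indicator-no ((a <? b) ×-dec (a <? c)) (λ (a<b , _) → ℕ.<-asym a<b b<a)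
          | indicator-yes ((b <? c) ×-dec (b <? a)) (b<c , b<a)
          | indicator-no ((c <? a) ×-dec (c <? b)) (λ (_ , c<b) → ℕ.<-asym b<c c<b) = refl
  ... | tri> _ _ b<a | tri> _ _ c<b | _
    rewrite indicator-no ((a <? b) ×-dec (a <? c)) (λ (a<b , _) → ℕ.<-asym a<b b<a)
          | indicator-no ((b <? c) ×-dec (b <? a)) (λ (b<c , _) → ℕ.<-asym b<c c<b)
          | indicator-yes ((c <? a) ×-dec (c <? b)) (ℕ.<-trans c<b b<a , c<b) = refl

  -- Each non-trivial orbit of σ is counted once, at its least element.
  module Orbits {N : ℕ} (σ : Fin N → Fin N) where

    fixed? : Decidable (λ i → σ i ≡ i)
    fixed? i = σ i Fin.≟ i

    #fixed : ℕ
    #fixed = count fixed?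

    module _ (σ²≡id : ∀ i → σ (σ i) ≡ i) where

      opens₂ : Fin N → ℕ
      opens₂ i = indicator (toℕ i <? toℕ (σ i))

      involution-partition : ∀ i → indicator (fixed? i) + (opens₂ i + opens₂ (σ i)) ≡ 1
      involution-partition i with fixed? i
      ... | yes σi≡i = cong suc (cong₂ _+_ (indicator-no (toℕ i <? toℕ (σ i)) (ℕ.<-irrefl (cong toℕ (sym σi≡i))))
                                           (indicator-no (toℕ (σ i) <? toℕ (σ (σ i)))
                                                         (ℕ.<-irrefl (cong toℕ (sym (cong σ σi≡i))))))
      ... | no σi≢i with ℕ.<-cmp (toℕ i) (toℕ (σ i))
      ...   | tri≈ _ i≡σi _ = ⊥-elim (σi≢i (sym (toℕ-injective i≡σi)))
      ...   | tri< i<σi _ _ =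
                cong₂ _+_ (indicator-yes (toℕ i <? toℕ (σ i)) i<σi)
                          (indicator-no (toℕ (σ i) <? toℕ (σ (σ i)))
                                        (λ lt → ℕ.<-asym i<σi (subst (λ j → toℕ (σ i) < toℕ j) (σ²≡id i) lt)))
      ...   | tri> _ _ σi<i =
                cong₂ _+_ (indicator-no (toℕ i <? toℕ (σ i)) (ℕ.<-asym σi<i))
                          (indicator-yes (toℕ (σ i) <? toℕ (σ (σ i)))
                                         (subst (λ j → toℕ (σ i) < toℕ j) (sym (σ²≡id i)) σi<i))

      involution-size : N ≡ #fixed + 2 * sum opens₂
      involution-size = begin
        N                                                     ≡⟨ sym (sum-const-1 N) ⟩
        sum {N} (λ _ → 1)                                     ≡⟨ sum-cong-≗ (λ i → sym (involution-partition i)) ⟩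
        sum (λ i → indicator (fixed? i) + (opens₂ i + opens₂ (σ i)))
                                                              ≡⟨ ∑-distrib-+ (λ i → indicator (fixed? i)) _ ⟩
        #fixed + sum (λ i → opens₂ i + opens₂ (σ i))          ≡⟨ cong (λ s → #fixed + s) (∑-distrib-+ opens₂ (λ i → opens₂ (σ i))) ⟩
        #fixed + (sum opens₂ + sum (λ i → opens₂ (σ i)))      ≡⟨ cong (λ s → #fixed + (sum opens₂ + s)) (sum-∘-bijection opens₂ σ σ σ²≡id σ²≡id) ⟩
        #fixed + (sum opens₂ + sum opens₂)                    ≡⟨ cong (λ s → #fixed + (sum opens₂ + s)) (sym (ℕ.+-identityʳ _)) ⟩
        #fixed + 2 * sum opens₂                               ∎
        where open ≡-Reasoning

      involution-size-mod-2 : N % 2 ≡ #fixed % 2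
      involution-size-mod-2 = m≡n+p*k⇒m%p≡n%p #fixed 2 (sum opens₂) involution-size

    module _ (σ³≡id : ∀ i → σ (σ (σ i)) ≡ i) where

      opens₃ : Fin N → ℕ
      opens₃ i = isLeast (toℕ i) (toℕ (σ i)) (toℕ (σ (σ i)))

      order3-partition : ∀ i → indicator (fixed? i) + (opens₃ i + opens₃ (σ i) + opens₃ (σ (σ i))) ≡ 1
      order3-partition i with fixed? i
      ... | yes σi≡i = cong suc (cong₂ _+_ (cong₂ _+_ (isLeast-≡ _ (cong toℕ (sym σi≡i)))
                                                      (isLeast-≡ _ (cong toℕ (trans σi≡i (sym σ²i≡i)))))
                                           (isLeast-≡ _ (cong toℕ (trans σ²i≡i (sym (σ³≡id i))))))
        where
        σ²i≡i : σ (σ i) ≡ i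
        σ²i≡i = trans (cong σ σi≡i) σi≡i
      ... | no σi≢i = begin
        opens₃ i + opens₃ (σ i) + opens₃ (σ (σ i))           ≡⟨ cong (λ j → isLeast a b c + isLeast b c (toℕ j) + isLeast c (toℕ j) (toℕ (σ j))) (σ³≡id i) ⟩
        isLeast a b c + isLeast b c a + isLeast c a (toℕ (σ i))    ≡⟨ isLeast-distinct a b c i≢σi σi≢σ²i i≢σ²i ⟩
        1                                                    ∎
        where
        open ≡-Reasoning
        a b c : ℕ
        a = toℕ i
        b = toℕ (σ i)
        c = toℕ (σ (σ i))
        i≢σi : ¬ toℕ i ≡ toℕ (σ i)
        i≢σi e = σi≢i (sym (toℕ-injective e))
        σi≢σ²i : ¬ toℕ (σ i) ≡ toℕ (σ (σ i))
        σi≢σ²i e = σi≢i (sym (trans (sym (σ³≡id i)) (trans (cong (λ j → σ (σ j)) (toℕ-injective e)) (σ³≡id (σ i)))))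
        i≢σ²i : ¬ toℕ i ≡ toℕ (σ (σ i))
        i≢σ²i e = σi≢i (trans (cong σ (toℕ-injective e)) (σ³≡id i))

      order3-size : N ≡ #fixed + 3 * sum opens₃
      order3-size = begin
        N                                                     ≡⟨ sym (sum-const-1 N) ⟩
        sum {N} (λ _ → 1)                                     ≡⟨ sum-cong-≗ (λ i → sym (order3-partition i)) ⟩
        sum (λ i → indicator (fixed? i) + (opens₃ i + opens₃ (σ i) + opens₃ (σ (σ i))))
                                                              ≡⟨ ∑-distrib-+ (λ i → indicator (fixed? i)) _ ⟩
        #fixed + sum (λ i → opens₃ i + opens₃ (σ i) + opens₃ (σ (σ i)))
                                                              ≡⟨ cong (λ s → #fixed + s) (trans (∑-distrib-+ _ (λ i → opens₃ (σ (σ i))))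
                                                                   (cong (_+ sum (λ i → opens₃ (σ (σ i)))) (∑-distrib-+ opens₃ (λ i → opens₃ (σ i))))) ⟩
        #fixed + (sum opens₃ + sum (λ i → opens₃ (σ i)) + sum (λ i → opens₃ (σ (σ i))))
                                                              ≡⟨ cong₂ (λ s s′ → #fixed + (sum opens₃ + s + s′))
                                                                   (sum-∘-bijection opens₃ σ σ² σ³≡id σ³≡id)
                                                                   (sum-∘-bijection opens₃ σ² σ σ³≡id σ³≡id) ⟩
        #fixed + (sum opens₃ + sum opens₃ + sum opens₃)       ≡⟨ cong (λ s → #fixed + s) (s+s+s≡3*s (sum opens₃)) ⟩
        #fixed + 3 * sum opens₃                               ∎
        where
        open ≡-Reasoning
        σ² : Fin N → Fin N
        σ² i = σ (σ i)
        s+s+s≡3*s : ∀ s → s + s + s ≡ 3 * s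
        s+s+s≡3*s s = trans (ℕ.+-assoc s s s) (cong (λ t → s + (s + t)) (sym (ℕ.+-identityʳ s)))

      order3-size-mod-3 : N % 3 ≡ #fixed % 3
      order3-size-mod-3 = m≡n+p*k⇒m%p≡n%p #fixed 3 (sum opens₃) order3-size

module IntegerRingSolver {q : ℕ} (F : FiniteField q) where
  open FiniteField F
  open import Algebra.Properties.Ring ring using (-‿distribˡ-*; -‿involutive; -0#≈0#; -‿+-comm)
  open import Relation.Binary.Reasoning.Setoid setoid

  fromℕ-+ : ∀ m n → fromℕ (m ℕ.+ n) ≈ fromℕ m + fromℕ n
  fromℕ-+ zero    n = sym (+-identityˡ _)
  fromℕ-+ (suc m) n = trans (+-congˡ (fromℕ-+ m n)) (sym (+-assoc _ _ _))

  fromℕ-* : ∀ m n → fromℕ (m ℕ.* n) ≈ fromℕ m * fromℕ n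
  fromℕ-* zero    n = sym (zeroˡ _)
  fromℕ-* (suc m) n = begin
    fromℕ (n ℕ.+ m ℕ.* n)           ≈⟨ fromℕ-+ n (m ℕ.* n) ⟩
    fromℕ n + fromℕ (m ℕ.* n)       ≈⟨ +-cong (sym (*-identityˡ _)) (fromℕ-* m n) ⟩
    1# * fromℕ n + fromℕ m * fromℕ n ≈⟨ distribʳ _ _ _ ⟨
    (1# + fromℕ m) * fromℕ n        ∎

  fromℤ : ℤ → Carrier
  fromℤ (+ n)    = fromℕ n
  fromℤ -[1+ n ] = - fromℕ (suc n)

  fromℤ-⊖ : ∀ m n → fromℤ (m ℤ.⊖ n) ≈ fromℕ m - fromℕ n
  fromℤ-⊖ m zero = begin
    fromℤ (m ℤ.⊖ 0)  ≡⟨ ≡.cong fromℤ (ℤ.⊖-≥ {m} {0} ℕ.z≤n) ⟩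
    fromℕ m          ≈⟨ +-identityʳ _ ⟨
    fromℕ m + 0#     ≈⟨ +-congˡ -0#≈0# ⟨
    fromℕ m - 0#     ∎
  fromℤ-⊖ zero (suc n) = begin
    fromℤ (0 ℤ.⊖ suc n)  ≈⟨ +-identityˡ _ ⟨
    0# - fromℕ (suc n)   ∎
  fromℤ-⊖ (suc m) (suc n) = begin
    fromℤ (suc m ℤ.⊖ suc n)            ≡⟨ ≡.cong fromℤ (ℤ.[1+m]⊖[1+n]≡m⊖n m n) ⟩
    fromℤ (m ℤ.⊖ n)                    ≈⟨ fromℤ-⊖ m n ⟩
    fromℕ m - fromℕ n                  ≈⟨ +-identityˡ _ ⟨
    0# + (fromℕ m - fromℕ n)           ≈⟨ +-congʳ (-‿inverseʳ 1#) ⟨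
    (1# - 1#) + (fromℕ m - fromℕ n)    ≈⟨ +-assoc _ _ _ ⟩
    1# + (- 1# + (fromℕ m - fromℕ n))  ≈⟨ +-congˡ (+-assoc _ _ _) ⟨
    1# + ((- 1# + fromℕ m) - fromℕ n)  ≈⟨ +-congˡ (+-congʳ (+-comm _ _)) ⟩
    1# + ((fromℕ m - 1#) - fromℕ n)    ≈⟨ +-congˡ (+-assoc _ _ _) ⟩
    1# + (fromℕ m + (- 1# - fromℕ n))  ≈⟨ +-assoc _ _ _ ⟨
    (1# + fromℕ m) + (- 1# - fromℕ n)  ≈⟨ +-congˡ (-‿+-comm _ _) ⟩
    (1# + fromℕ m) - (1# + fromℕ n)    ∎

  fromℤ-+ : ∀ i j → fromℤ (i ℤ.+ j) ≈ fromℤ i + fromℤ j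
  fromℤ-+ -[1+ m ] -[1+ n ] = begin
    - fromℕ (suc (suc (m ℕ.+ n)))     ≡⟨ ≡.cong (λ k → - fromℕ (suc k)) (ℕ.+-suc m n) ⟨
    - fromℕ (suc m ℕ.+ suc n)         ≈⟨ -‿cong (fromℕ-+ (suc m) (suc n)) ⟩
    - (fromℕ (suc m) + fromℕ (suc n)) ≈⟨ -‿+-comm _ _ ⟨
    - fromℕ (suc m) - fromℕ (suc n)   ∎
  fromℤ-+ -[1+ m ] (+ n) = trans (fromℤ-⊖ n (suc m)) (+-comm _ _)
  fromℤ-+ (+ m) -[1+ n ] = fromℤ-⊖ m (suc n)
  fromℤ-+ (+ m) (+ n)    = fromℕ-+ m n

  fromℤ-neg : ∀ i → fromℤ (ℤ.- i) ≈ - fromℤ i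
  fromℤ-neg -[1+ n ]    = sym (-‿involutive _)
  fromℤ-neg (+ zero)    = sym -0#≈0#
  fromℤ-neg (+ (suc n)) = refl

  fromSign : Sign → Carrier
  fromSign Sign.+ = 1#
  fromSign Sign.- = - 1#

  fromSign-* : ∀ s t → fromSign (s Sign.* t) ≈ fromSign s * fromSign t
  fromSign-* Sign.+ t      = sym (*-identityˡ _)
  fromSign-* Sign.- Sign.+ = sym (*-identityʳ _)
  fromSign-* Sign.- Sign.- = begin
    1#            ≈⟨ -‿involutive _ ⟨
    - (- 1#)      ≈⟨ -‿cong (*-identityˡ _) ⟨
    - (1# * - 1#) ≈⟨ -‿distribˡ-* _ _ ⟩
    - 1# * - 1#   ∎

  fromℤ-◃ : ∀ s n → fromℤ (s ℤ.◃ n) ≈ fromSign s * fromℕ n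
  fromℤ-◃ s       zero    = sym (zeroʳ _)
  fromℤ-◃ Sign.+ (suc n) = sym (*-identityˡ _)
  fromℤ-◃ Sign.- (suc n) = trans (-‿cong (sym (*-identityˡ _))) (-‿distribˡ-* _ _)

  fromℤ-sign-abs : ∀ i → fromℤ i ≈ fromSign (ℤ.sign i) * fromℕ ℤ.∣ i ∣
  fromℤ-sign-abs i = trans (reflexive (≡.cong fromℤ (≡.sym (ℤ.◃-inverse i)))) (fromℤ-◃ (ℤ.sign i) ℤ.∣ i ∣)

  fromℤ-* : ∀ i j → fromℤ (i ℤ.* j) ≈ fromℤ i * fromℤ j
  fromℤ-* i j = begin
    fromℤ (i ℤ.* j)
      ≈⟨ fromℤ-◃ (ℤ.sign i Sign.* ℤ.sign j) (ℤ.∣ i ∣ ℕ.* ℤ.∣ j ∣) ⟩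
    fromSign (ℤ.sign i Sign.* ℤ.sign j) * fromℕ (ℤ.∣ i ∣ ℕ.* ℤ.∣ j ∣)
      ≈⟨ *-cong (fromSign-* (ℤ.sign i) (ℤ.sign j)) (fromℕ-* ℤ.∣ i ∣ ℤ.∣ j ∣) ⟩
    (fromSign (ℤ.sign i) * fromSign (ℤ.sign j)) * (fromℕ ℤ.∣ i ∣ * fromℕ ℤ.∣ j ∣)
      ≈⟨ *-assoc _ _ _ ⟩
    fromSign (ℤ.sign i) * (fromSign (ℤ.sign j) * (fromℕ ℤ.∣ i ∣ * fromℕ ℤ.∣ j ∣))
      ≈⟨ *-congˡ (trans (sym (*-assoc _ _ _)) (trans (*-congʳ (*-comm _ _)) (*-assoc _ _ _))) ⟩
    fromSign (ℤ.sign i) * (fromℕ ℤ.∣ i ∣ * (fromSign (ℤ.sign j) * fromℕ ℤ.∣ j ∣))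
      ≈⟨ *-assoc _ _ _ ⟨
    (fromSign (ℤ.sign i) * fromℕ ℤ.∣ i ∣) * (fromSign (ℤ.sign j) * fromℕ ℤ.∣ j ∣)
      ≈⟨ *-cong (fromℤ-sign-abs i) (fromℤ-sign-abs j) ⟨
    fromℤ i * fromℤ j ∎

  -- Agrees with fromℤ, but sends + 1 to 1# on the nose, so that the solver's
  -- constant 1 matches the 1# at the bottom of _^_ definitionally.
  ⟦_⟧ℤ : ℤ → Carrier
  ⟦ + 1 ⟧ℤ = 1#
  ⟦ i   ⟧ℤ = fromℤ i

  ⟦⟧ℤ≈fromℤ : ∀ i → ⟦ i ⟧ℤ ≈ fromℤ i
  ⟦⟧ℤ≈fromℤ (+ 0)             = refl
  ⟦⟧ℤ≈fromℤ (+ 1)             = sym (+-identityʳ 1#)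
  ⟦⟧ℤ≈fromℤ (+ (suc (suc n))) = refl
  ⟦⟧ℤ≈fromℤ -[1+ n ]          = refl

  ⟦⟧ℤ-homomorphism : ℤ.+-*-rawRing -Raw-AlmostCommutative⟶ fromCommutativeRing cring
  ⟦⟧ℤ-homomorphism = record
    { ⟦_⟧    = ⟦_⟧ℤ
    ; +-homo = λ i j → trans (≈fromℤ (i ℤ.+ j)) (trans (fromℤ-+ i j) (sym (+-cong (≈fromℤ i) (≈fromℤ j))))
    ; *-homo = λ i j → trans (≈fromℤ (i ℤ.* j)) (trans (fromℤ-* i j) (sym (*-cong (≈fromℤ i) (≈fromℤ j))))
    ; -‿homo = λ i → trans (≈fromℤ (ℤ.- i)) (trans (fromℤ-neg i) (sym (-‿cong (≈fromℤ i))))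
    ; 0-homo = refl
    ; 1-homo = refl
    }
    where
    ≈fromℤ : ∀ i → ⟦ i ⟧ℤ ≈ fromℤ i
    ≈fromℤ = ⟦⟧ℤ≈fromℤ

  ⟦⟧ℤ-≟ : ∀ i j → Maybe (⟦ i ⟧ℤ ≈ ⟦ j ⟧ℤ)
  ⟦⟧ℤ-≟ i j with i ℤ.≟ j
  ... | yes ≡.refl = just refl
  ... | no _       = nothing

  open Algebra.Solver.Ring ℤ.+-*-rawRing (fromCommutativeRing cring) ⟦⟧ℤ-homomorphism ⟦⟧ℤ-≟ public

module FiniteFieldFacts {q : ℕ} (F : FiniteField q) where
  open FiniteField F hiding (zero)
  open Counting
  open IntegerRingSolver F using (solve; _:=_; _:+_; _:*_; _:-_; :-_; con)
  open import Algebra.Properties.Ring ring using (-0#≈0#; -‿involutive)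
  import Relation.Binary.Reasoning.Setoid setoid as ≈-Reasoning
  module card = Inverse card

  infix 4 _≟_
  _≟_ : (x y : Carrier) → Dec (x ≈ y)
  x ≟ y with card.from x Fin.≟ card.from y
  ... | yes eq = yes (trans (sym (card.strictlyInverseˡ x)) (trans (card.to-cong eq) (card.strictlyInverseˡ y)))
  ... | no neq = no (λ x≈y → neq (card.from-cong x≈y))

  x-y≈0⇒x≈y : ∀ {x y} → x - y ≈ 0# → x ≈ y
  x-y≈0⇒x≈y {x} {y} eq = begin
    x             ≈⟨ solve 2 (λ x y → x := (x :- y) :+ y) refl x y ⟩
    (x - y) + y   ≈⟨ +-congʳ eq ⟩
    0# + y        ≈⟨ +-identityˡ y ⟩
    y             ∎
    where open ≈-Reasoning

  x≈y⇒x-y≈0 : ∀ {x y} → x ≈ y → x - y ≈ 0#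
  x≈y⇒x-y≈0 {x} {y} eq = trans (+-congʳ eq) (-‿inverseʳ y)

  -- A polynomial consequence A ≈ 0# of hypotheses Rᵢ ≈ 0# is proved by exhibiting
  -- the identity A ≈ Σ cᵢ * Rᵢ (checked by the ring solver) and substituting.
  combination₁≈0 : ∀ {A c R} → A ≈ c * R → R ≈ 0# → A ≈ 0#
  combination₁≈0 eq R≈0 = trans eq (trans (*-congˡ R≈0) (zeroʳ _))

  combination₂≈0 : ∀ {A c R d S} → A ≈ c * R + d * S → R ≈ 0# → S ≈ 0# → A ≈ 0#
  combination₂≈0 eq R≈0 S≈0 =
    trans eq (trans (+-cong (combination₁≈0 refl R≈0) (combination₁≈0 refl S≈0)) (+-identityˡ 0#))

  combination₃≈0 : ∀ {A c R d S e T} → A ≈ c * R + d * S + e * T → R ≈ 0# → S ≈ 0# → T ≈ 0# → A ≈ 0#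
  combination₃≈0 eq R≈0 S≈0 T≈0 =
    trans eq (trans (+-cong (combination₂≈0 refl R≈0 S≈0) (combination₁≈0 refl T≈0)) (+-identityˡ 0#))

  *-cancelˡ-≈0 : ∀ {x y} → ¬ x ≈ 0# → x * y ≈ 0# → y ≈ 0#
  *-cancelˡ-≈0 {x} {y} x≉0 xy≈0 with inverse x x≉0
  ... | x′ , xx′≈1 = combination₂≈0 (solve 3 (λ x x′ y → y := x′ :* (x :* y) :+ (:- y) :* (x :* x′ :- con (+ 1))) refl x x′ y)
                                    xy≈0 (x≈y⇒x-y≈0 xx′≈1)

  *≈0⇒≈0⊎≈0 : ∀ {x y} → x * y ≈ 0# → x ≈ 0# ⊎ y ≈ 0#
  *≈0⇒≈0⊎≈0 {x} xy≈0 with x ≟ 0#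
  ... | yes x≈0 = inj₁ x≈0
  ... | no  x≉0 = inj₂ (*-cancelˡ-≈0 x≉0 xy≈0)

  *-≉0 : ∀ {x y} → ¬ x ≈ 0# → ¬ y ≈ 0# → ¬ x * y ≈ 0#
  *-≉0 x≉0 y≉0 xy≈0 = [ x≉0 , y≉0 ]′ (*≈0⇒≈0⊎≈0 xy≈0)

  -- the inverse, with the junk value 0⁻¹ = 0
  _⁻¹ : Carrier → Carrier
  x ⁻¹ with x ≟ 0#
  ... | yes _   = 0#
  ... | no  x≉0 = proj₁ (inverse x x≉0)

  x*x⁻¹≈1 : ∀ {x} → ¬ x ≈ 0# → x * x ⁻¹ ≈ 1#
  x*x⁻¹≈1 {x} x≉0 with x ≟ 0#
  ... | yes x≈0 = ⊥-elim (x≉0 x≈0)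
  ... | no  x≉0 = proj₂ (inverse x x≉0)

  x*y≈1⇒x≉0 : ∀ {x y} → x * y ≈ 1# → ¬ x ≈ 0#
  x*y≈1⇒x≉0 {x} {y} xy≈1 x≈0 = 1≉0 (trans (sym xy≈1) (trans (*-congʳ x≈0) (zeroˡ y)))

  x*y≈1⇒x⁻¹≈y : ∀ {x y} → x * y ≈ 1# → x ⁻¹ ≈ y
  x*y≈1⇒x⁻¹≈y {x} {y} xy≈1 = x-y≈0⇒x≈y (*-cancelˡ-≈0 (x*y≈1⇒x≉0 xy≈1)
    (combination₂≈0 (solve 3 (λ x x′ y → x :* (x′ :- y) := con (+ 1) :* (x :* x′ :- con (+ 1)) :+ con -[1+ 0 ] :* (x :* y :- con (+ 1)))
                             refl x (x ⁻¹) y)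
                    (x≈y⇒x-y≈0 (x*x⁻¹≈1 (x*y≈1⇒x≉0 xy≈1))) (x≈y⇒x-y≈0 xy≈1)))

  x≈0⇒x⁻¹≈0 : ∀ {x} → x ≈ 0# → x ⁻¹ ≈ 0#
  x≈0⇒x⁻¹≈0 {x} x≈0 with x ≟ 0#
  ... | yes _   = refl
  ... | no  x≉0 = ⊥-elim (x≉0 x≈0)

  ⁻¹-cong : ∀ {x y} → x ≈ y → x ⁻¹ ≈ y ⁻¹
  ⁻¹-cong {x} {y} x≈y = cases (x ≟ 0#)
    where
    cases : Dec (x ≈ 0#) → x ⁻¹ ≈ y ⁻¹
    cases (yes x≈0) = trans (x≈0⇒x⁻¹≈0 x≈0) (sym (x≈0⇒x⁻¹≈0 (trans (sym x≈y) x≈0)))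
    cases (no  x≉0) = x*y≈1⇒x⁻¹≈y (trans (*-congʳ x≈y) (x*x⁻¹≈1 (λ y≈0 → x≉0 (trans x≈y y≈0))))

  module _ (σ : Carrier → Carrier) (σ-cong : σ Preserves _≈_ ⟶ _≈_) where

    private
      σ̂ : Fin q → Fin q
      σ̂ i = card.from (σ (card.to i))

      to-σ̂ : ∀ i → card.to (σ̂ i) ≈ σ (card.to i)
      to-σ̂ i = card.strictlyInverseˡ _

      to≈⇒≡from : ∀ {i x} → card.to i ≈ x → i ≡ card.from x
      to≈⇒≡from {i} eq = ≡.trans (≡.sym (card.strictlyInverseʳ i)) (card.from-cong eq)

      σ̂-fixed⇒σ-fixed : ∀ {i} → σ̂ i ≡ i → σ (card.to i) ≈ card.to i
      σ̂-fixed⇒σ-fixed {i} eq = trans (sym (to-σ̂ i)) (card.to-cong eq)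

      σ̂²≡id : (∀ x → σ (σ x) ≈ x) → ∀ i → σ̂ (σ̂ i) ≡ i
      σ̂²≡id σ²≈id i = ≡.sym (to≈⇒≡from (sym (trans (σ-cong (to-σ̂ i)) (σ²≈id _))))

      σ̂³≡id : (∀ x → σ (σ (σ x)) ≈ x) → ∀ i → σ̂ (σ̂ (σ̂ i)) ≡ i
      σ̂³≡id σ³≈id i = ≡.sym (to≈⇒≡from (sym (trans (σ-cong (trans (to-σ̂ _) (σ-cong (to-σ̂ i)))) (σ³≈id _))))

      #fixed-unique : ∀ a → σ a ≈ a → (∀ x → σ x ≈ x → x ≈ a) → Orbits.#fixed σ̂ ≡ 1
      #fixed-unique a σa≈a unique = count-unique (Orbits.fixed? σ̂) (card.from a)
        (to≈⇒≡from (trans (to-σ̂ _) (trans (σ-cong (card.strictlyInverseˡ a)) σa≈a)))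
        (λ i eq → to≈⇒≡from (unique _ (σ̂-fixed⇒σ-fixed eq)))

      #fixed-none : (∀ x → ¬ σ x ≈ x) → Orbits.#fixed σ̂ ≡ 0
      #fixed-none no-fixed = count-none (Orbits.fixed? σ̂) (λ i eq → no-fixed _ (σ̂-fixed⇒σ-fixed eq))

    involution-uniqueFixedPoint⇒q%2≡1 : (∀ x → σ (σ x) ≈ x) → ∀ a → σ a ≈ a → (∀ x → σ x ≈ x → x ≈ a) →
                                       q % 2 ≡ 1
    involution-uniqueFixedPoint⇒q%2≡1 σ²≈id a σa≈a unique =
      ≡.trans (Orbits.involution-size-mod-2 σ̂ (σ̂²≡id σ²≈id)) (≡.cong (_% 2) (#fixed-unique a σa≈a unique))

    involution-fixedPointFree⇒q%2≡0 : (∀ x → σ (σ x) ≈ x) → (∀ x → ¬ σ x ≈ x) → q % 2 ≡ 0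
    involution-fixedPointFree⇒q%2≡0 σ²≈id no-fixed =
      ≡.trans (Orbits.involution-size-mod-2 σ̂ (σ̂²≡id σ²≈id)) (≡.cong (_% 2) (#fixed-none no-fixed))

    order3-uniqueFixedPoint⇒q%3≡1 : (∀ x → σ (σ (σ x)) ≈ x) → ∀ a → σ a ≈ a → (∀ x → σ x ≈ x → x ≈ a) →
                                   q % 3 ≡ 1
    order3-uniqueFixedPoint⇒q%3≡1 σ³≈id a σa≈a unique =
      ≡.trans (Orbits.order3-size-mod-3 σ̂ (σ̂³≡id σ³≈id)) (≡.cong (_% 3) (#fixed-unique a σa≈a unique))

    order3-fixedPointFree⇒q%3≡0 : (∀ x → σ (σ (σ x)) ≈ x) → (∀ x → ¬ σ x ≈ x) → q % 3 ≡ 0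
    order3-fixedPointFree⇒q%3≡0 σ³≈id no-fixed =
      ≡.trans (Orbits.order3-size-mod-3 σ̂ (σ̂³≡id σ³≈id)) (≡.cong (_% 3) (#fixed-none no-fixed))

  x+1≉x : ∀ x → ¬ x + 1# ≈ x
  x+1≉x x eq = 1≉0 (x-y≈0⇒x≈y (combination₁≈0 (solve 1 (λ x → con (+ 1) :- con (+ 0) := con (+ 1) :* ((x :+ con (+ 1)) :- x)) refl x)
                                              (x≈y⇒x-y≈0 eq)))

  2≈0⇒q%2≡0 : fromℕ 2 ≈ 0# → q % 2 ≡ 0
  2≈0⇒q%2≡0 2≈0 = involution-fixedPointFree⇒q%2≡0 (_+ 1#) +-congʳ
    (λ x → x-y≈0⇒x≈y (combination₁≈0 (solve 1 (λ x → x :+ con (+ 1) :+ con (+ 1) :- x := con (+ 1) :* con (+ 2)) refl x) 2≈0))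
    x+1≉x

  q%2≡1⇒2≉0 : q % 2 ≡ 1 → ¬ fromℕ 2 ≈ 0#
  q%2≡1⇒2≉0 q%2≡1 2≈0 = 0≢1 (≡.trans (≡.sym (2≈0⇒q%2≡0 2≈0)) q%2≡1)
    where
    0≢1 : 0 ≢ 1
    0≢1 ()

  2≉0⇒q%2≡1 : ¬ fromℕ 2 ≈ 0# → q % 2 ≡ 1
  2≉0⇒q%2≡1 2≉0 = involution-uniqueFixedPoint⇒q%2≡1 -_ -‿cong -‿involutive 0# -0#≈0#
    (λ x -x≈x → *-cancelˡ-≈0 2≉0 (combination₁≈0 (solve 1 (λ x → con (+ 2) :* x := con -[1+ 0 ] :* (:- x :- x)) refl x)
                                                 (x≈y⇒x-y≈0 -x≈x)))

  3≈0⇒q%3≡0 : fromℕ 3 ≈ 0# → q % 3 ≡ 0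
  3≈0⇒q%3≡0 3≈0 = order3-fixedPointFree⇒q%3≡0 (_+ 1#) +-congʳ
    (λ x → x-y≈0⇒x≈y (combination₁≈0 (solve 1 (λ x → x :+ con (+ 1) :+ con (+ 1) :+ con (+ 1) :- x := con (+ 1) :* con (+ 3)) refl x) 3≈0))
    x+1≉x

  q%3≢0⇒3≉0 : ¬ q % 3 ≡ 0 → ¬ fromℕ 3 ≈ 0#
  q%3≢0⇒3≉0 q%3≢0 3≈0 = q%3≢0 (3≈0⇒q%3≡0 3≈0)

  Φ₆ : Carrier → Carrier
  Φ₆ x = x * x - x + 1#

  -- If Φ₆ ω ≈ 0# then multiplication by -ω has order three and fixes only 0#.
  Φ₆-root⇒q%3≡1 : ¬ fromℕ 3 ≈ 0# → ∀ {ω} → Φ₆ ω ≈ 0# → q % 3 ≡ 1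
  Φ₆-root⇒q%3≡1 3≉0 {ω} Φ₆ω≈0 = order3-uniqueFixedPoint⇒q%3≡1 (- ω *_) *-congˡ
    (λ y → x-y≈0⇒x≈y (combination₁≈0 (solve 2 (λ ω y → (:- ω) :* ((:- ω) :* ((:- ω) :* y)) :- y := (:- ((ω :+ con (+ 1)) :* y)) :* (ω :* ω :- ω :+ con (+ 1))) refl ω y) Φ₆ω≈0))
    0# (zeroʳ _)
    (λ y -ωy≈y → *-cancelˡ-≈0 -ω-1≉0 (combination₁≈0 (solve 2 (λ ω y → (:- ω :- con (+ 1)) :* y := con (+ 1) :* ((:- ω) :* y :- y)) refl ω y)
                                                    (x≈y⇒x-y≈0 -ωy≈y)))
    where
    -ω-1≉0 : ¬ - ω - 1# ≈ 0#
    -ω-1≉0 eq = 3≉0 (combination₂≈0 (solve 1 (λ ω → con (+ 3) := con (+ 1) :* (ω :* ω :- ω :+ con (+ 1)) :+ (ω :- con (+ 2)) :* (:- ω :- con (+ 1))) refl ω)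
                                    Φ₆ω≈0 eq)

  1-x≈1⇒x≈0 : ∀ {x} → 1# - x ≈ 1# → x ≈ 0#
  1-x≈1⇒x≈0 {x} eq = combination₁≈0 (solve 1 (λ x → x := con -[1+ 0 ] :* ((con (+ 1) :- x) :- con (+ 1))) refl x) (x≈y⇒x-y≈0 eq)

  x≈0⇒[1-x]⁻¹≈1 : ∀ {x} → x ≈ 0# → (1# - x) ⁻¹ ≈ 1#
  x≈0⇒[1-x]⁻¹≈1 {x} x≈0 = x*y≈1⇒x⁻¹≈y (trans (*-identityʳ _) (trans (+-congˡ (trans (-‿cong x≈0) -0#≈0#)) (+-identityʳ 1#)))

  -- The projective line F ∪ {∞} as Fin (suc q): Fin.zero is ∞ and Fin.suc i is card.to i.
  point : Carrier → Fin (suc q)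
  point x = Fin.suc (card.from x)

  point-cong : ∀ {x y} → x ≈ y → point x ≡ point y
  point-cong x≈y = ≡.cong Fin.suc (card.from-cong x≈y)

  point-injective : ∀ {x y} → point x ≡ point y → x ≈ y
  point-injective {x} {y} eq =
    trans (sym (card.strictlyInverseˡ x)) (trans (card.to-cong (suc-injective eq)) (card.strictlyInverseˡ y))

  -- x ↦ 1 / (1 - x) on the projective line, with 1 ↦ ∞ ↦ 0
  mobiusAt : Carrier → Fin (suc q)
  mobiusAt x with x ≟ 1#
  ... | yes _ = Fin.zero
  ... | no  _ = point ((1# - x) ⁻¹)

  mobius : Fin (suc q) → Fin (suc q)
  mobius Fin.zero    = point 0#
  mobius (Fin.suc i) = mobiusAt (card.to i)

  mobiusAt-≈1 : ∀ {x} → x ≈ 1# → mobiusAt x ≡ Fin.zero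
  mobiusAt-≈1 {x} x≈1 with x ≟ 1#
  ... | yes _   = ≡.refl
  ... | no  x≉1 = ⊥-elim (x≉1 x≈1)

  mobiusAt-≉1 : ∀ {x} → ¬ x ≈ 1# → mobiusAt x ≡ point ((1# - x) ⁻¹)
  mobiusAt-≉1 {x} x≉1 with x ≟ 1#
  ... | yes x≈1 = ⊥-elim (x≉1 x≈1)
  ... | no  _   = ≡.refl

  mobiusAt-cong : ∀ {x y} → x ≈ y → mobiusAt x ≡ mobiusAt y
  mobiusAt-cong {x} {y} x≈y = cases (x ≟ 1#)
    where
    cases : Dec (x ≈ 1#) → mobiusAt x ≡ mobiusAt y
    cases (yes x≈1) = ≡.trans (mobiusAt-≈1 x≈1) (≡.sym (mobiusAt-≈1 (trans (sym x≈y) x≈1)))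
    cases (no  x≉1) = ≡.trans (mobiusAt-≉1 x≉1)
      (≡.trans (point-cong (⁻¹-cong (+-congˡ (-‿cong x≈y)))) (≡.sym (mobiusAt-≉1 (λ y≈1 → x≉1 (trans x≈y y≈1)))))

  mobius-point : ∀ x → mobius (point x) ≡ mobiusAt x
  mobius-point x = mobiusAt-cong (card.strictlyInverseˡ x)

  mobius³-generic : ∀ {x} → ¬ x ≈ 1# → ¬ x ≈ 0# → mobius (mobius (mobiusAt x)) ≡ point x
  mobius³-generic {x} x≉1 x≉0 = begin
    mobius (mobius (mobiusAt x))  ≡⟨ ≡.cong (λ p → mobius (mobius p)) (mobiusAt-≉1 x≉1) ⟩
    mobius (mobius (point y))     ≡⟨ ≡.cong mobius (≡.trans (mobius-point y) (mobiusAt-≉1 y≉1)) ⟩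
    mobius (point z)              ≡⟨ ≡.trans (mobius-point z) (mobiusAt-≉1 z≉1) ⟩
    point ((1# - z) ⁻¹)           ≡⟨ point-cong (x*y≈1⇒x⁻¹≈y [1-z]x≈1) ⟩
    point x                       ∎
    where
    open ≡.≡-Reasoning
    y z : Carrier
    y = (1# - x) ⁻¹
    z = (1# - y) ⁻¹
    [1-x]y≈1 : (1# - x) * y ≈ 1#
    [1-x]y≈1 = x*x⁻¹≈1 (λ 1-x≈0 → x≉1 (sym (x-y≈0⇒x≈y 1-x≈0)))
    y≉1 : ¬ y ≈ 1#
    y≉1 y≈1 = x≉0 (1-x≈1⇒x≈0 (trans (sym (*-identityʳ _)) (trans (*-congˡ (sym y≈1)) [1-x]y≈1)))
    [1-y]z≈1 : (1# - y) * z ≈ 1#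
    [1-y]z≈1 = x*x⁻¹≈1 (λ 1-y≈0 → y≉1 (sym (x-y≈0⇒x≈y 1-y≈0)))
    z≉1 : ¬ z ≈ 1#
    z≉1 z≈1 = x*y≈1⇒x≉0 (trans (*-comm _ _) [1-x]y≈1)
      (1-x≈1⇒x≈0 (trans (sym (*-identityʳ _)) (trans (*-congˡ (sym z≈1)) [1-y]z≈1)))
    [1-z]x≈1 : (1# - z) * x ≈ 1#
    [1-z]x≈1 = x-y≈0⇒x≈y (combination₂≈0
      (solve 3 (λ x y z → (con (+ 1) :- z) :* x :- con (+ 1)
                          := (con (+ 1) :- x) :* ((con (+ 1) :- y) :* z :- con (+ 1)) :+ z :* ((con (+ 1) :- x) :* y :- con (+ 1)))
             refl x y z)
      (x≈y⇒x-y≈0 [1-y]z≈1) (x≈y⇒x-y≈0 [1-x]y≈1))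

  mobiusAt-0 : mobiusAt 0# ≡ point 1#
  mobiusAt-0 = ≡.trans (mobiusAt-≉1 (λ 0≈1 → 1≉0 (sym 0≈1))) (point-cong (x≈0⇒[1-x]⁻¹≈1 refl))

  mobius³-at : ∀ x → mobius (mobius (mobiusAt x)) ≡ point x
  mobius³-at x = cases (x ≟ 1#) (x ≟ 0#)
    where
    cases : Dec (x ≈ 1#) → Dec (x ≈ 0#) → mobius (mobius (mobiusAt x)) ≡ point x
    cases (yes x≈1) _ = ≡.trans (≡.cong (λ p → mobius (mobius p)) (mobiusAt-≈1 x≈1))
      (≡.trans (mobius-point 0#) (≡.trans mobiusAt-0 (point-cong (sym x≈1))))
    cases (no x≉1) (yes x≈0) = ≡.trans (≡.cong (λ p → mobius (mobius p)) (≡.trans (mobiusAt-≉1 x≉1) (point-cong (x≈0⇒[1-x]⁻¹≈1 x≈0))))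
      (≡.trans (≡.cong mobius (≡.trans (mobius-point 1#) (mobiusAt-≈1 refl))) (point-cong (sym x≈0)))
    cases (no x≉1) (no x≉0) = mobius³-generic x≉1 x≉0

  mobius³ : ∀ p → mobius (mobius (mobius p)) ≡ p
  mobius³ Fin.zero    = ≡.trans (≡.cong mobius (≡.trans (mobius-point 0#) mobiusAt-0))
                                (≡.trans (mobius-point 1#) (mobiusAt-≈1 refl))
  mobius³ (Fin.suc i) = ≡.trans (mobius³-at (card.to i)) (≡.cong Fin.suc (card.strictlyInverseʳ i))

  mobiusAt-fixed⇒Φ₆≈0 : ∀ {x} → mobiusAt x ≡ point x → Φ₆ x ≈ 0#
  mobiusAt-fixed⇒Φ₆≈0 {x} fixed = cases (x ≟ 1#)
    where
    cases : Dec (x ≈ 1#) → Φ₆ x ≈ 0#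
    cases (yes x≈1) = ⊥-elim (0≢1+n (≡.trans (≡.sym (mobiusAt-≈1 x≈1)) fixed))
    cases (no  x≉1) = combination₁≈0 (solve 1 (λ x → x :* x :- x :+ con (+ 1) := con -[1+ 0 ] :* ((con (+ 1) :- x) :* x :- con (+ 1))) refl x)
                                     (x≈y⇒x-y≈0 [1-x]x≈1)
      where
      [1-x]x≈1 : (1# - x) * x ≈ 1#
      [1-x]x≈1 = trans (*-congˡ (sym (point-injective (≡.trans (≡.sym (mobiusAt-≉1 x≉1)) fixed))))
                       (x*x⁻¹≈1 (λ 1-x≈0 → x≉1 (sym (x-y≈0⇒x≈y 1-x≈0))))

  mobius-fixed⇒Φ₆-root : ∃[ p ] mobius p ≡ p → ∃[ x ] Φ₆ x ≈ 0#
  mobius-fixed⇒Φ₆-root (Fin.suc i , fixed) =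
    card.to i , mobiusAt-fixed⇒Φ₆≈0 (≡.trans fixed (≡.cong Fin.suc (≡.sym (card.strictlyInverseʳ i))))

  -- The projective line has q + 1 ≡ 2 (mod 3) points, so mobius must have a fixed point.
  q%3≡1⇒Φ₆-root : q % 3 ≡ 1 → ∃[ x ] Φ₆ x ≈ 0#
  q%3≡1⇒Φ₆-root q%3≡1 = mobius-fixed⇒Φ₆-root (count≢0⇒∃ (Orbits.fixed? mobius) #fixed≢0)
    where
    [1+q]%3≡2 : suc q % 3 ≡ 2
    [1+q]%3≡2 = ≡.trans (%-distribˡ-+ 1 q 3) (≡.cong (λ r → suc r % 3) q%3≡1)
    #fixed≢0 : Orbits.#fixed mobius ≢ 0
    #fixed≢0 #fixed≡0 = 2≢0 (≡.trans (≡.sym [1+q]%3≡2) (≡.trans (Orbits.order3-size-mod-3 mobius mobius³) (≡.cong (_% 3) #fixed≡0)))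
      where
      2≢0 : 2 ≢ 0
      2≢0 ()

  Sqrt-3 : Carrier → Set
  Sqrt-3 y = y * y + fromℕ 3 ≈ 0#

  Φ₆-root⇒Sqrt-3 : ∀ {x} → Φ₆ x ≈ 0# → Sqrt-3 (fromℕ 2 * x - 1#)
  Φ₆-root⇒Sqrt-3 {x} Φ₆x≈0 = combination₁≈0
    (solve 1 (λ x → (con (+ 2) :* x :- con (+ 1)) :* (con (+ 2) :* x :- con (+ 1)) :+ con (+ 3)
                    := con (+ 4) :* (x :* x :- x :+ con (+ 1))) refl x)
    Φ₆x≈0

  Sqrt-3⇒Φ₆-root : ∀ {h y} → fromℕ 2 * h ≈ 1# → Sqrt-3 y → Φ₆ (h * (1# + y)) ≈ 0#
  Sqrt-3⇒Φ₆-root {h} {y} 2h≈1 y²+3≈0 = combination₂≈0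
    (solve 2 (λ h y → (h :* (con (+ 1) :+ y)) :* (h :* (con (+ 1) :+ y)) :- h :* (con (+ 1) :+ y) :+ con (+ 1)
                      := (h :* h) :* (y :* y :+ con (+ 3)) :+ (h :* y :- h :- con (+ 1)) :* (con (+ 2) :* h :- con (+ 1)))
           refl h y)
    y²+3≈0 (x≈y⇒x-y≈0 2h≈1)

  Sqrt-3⇒q%3≡1 : ¬ fromℕ 2 ≈ 0# → ¬ fromℕ 3 ≈ 0# → ∀ {y} → Sqrt-3 y → q % 3 ≡ 1
  Sqrt-3⇒q%3≡1 2≉0 3≉0 {y} y²+3≈0 =
    Φ₆-root⇒q%3≡1 3≉0 {fromℕ 2 ⁻¹ * (1# + y)} (Sqrt-3⇒Φ₆-root (x*x⁻¹≈1 2≉0) y²+3≈0)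

  q%3≡1⇒∃Sqrt-3 : q % 3 ≡ 1 → ∃[ y ] Sqrt-3 y
  q%3≡1⇒∃Sqrt-3 q%3≡1 =
    let x , Φ₆x≈0 = q%3≡1⇒Φ₆-root q%3≡1 in fromℕ 2 * x - 1# , Φ₆-root⇒Sqrt-3 {x} Φ₆x≈0

  ^-cong : ∀ {a b} n → a ≈ b → a ^ n ≈ b ^ n
  ^-cong zero    a≈b = refl
  ^-cong (suc n) a≈b = *-cong a≈b (^-cong n a≈b)

  x^n*x^n≈[x*x]^n : ∀ x n → x ^ n * x ^ n ≈ (x * x) ^ n
  x^n*x^n≈[x*x]^n x zero    = *-identityʳ 1#
  x^n*x^n≈[x*x]^n x (suc n) = trans (solve 3 (λ x a b → (x :* a) :* (x :* b) := (x :* x) :* (a :* b)) refl x (x ^ n) (x ^ n))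
                                    (*-congˡ (x^n*x^n≈[x*x]^n x n))

  module ∏ = Algebra.Properties.CommutativeMonoid.Sum *-commutativeMonoid

  ∏ : ∀ {N} → (Fin N → Carrier) → Carrier
  ∏ = ∏.sum

  ∏-scale : ∀ {N} x (f : Fin N → Carrier) → ∏ (λ i → x * f i) ≈ x ^ N * ∏ f
  ∏-scale {zero}  x f = sym (*-identityʳ 1#)
  ∏-scale {suc N} x f = trans (*-congˡ (∏-scale x (λ i → f (Fin.suc i)))) (interchange x (f Fin.zero) _ _)
    where
    interchange : ∀ a b c d → (a * b) * (c * d) ≈ (a * c) * (b * d)
    interchange a b c d = solve 4 (λ a b c d → (a :* b) :* (c :* d) := (a :* c) :* (b :* d)) refl a b c d

  ∏-scale-one : ∀ {N} x (f g : Fin N → Carrier) a →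
                (∀ i → i ≢ a → f i ≈ g i) → f a ≈ x * g a → ∏ f ≈ x * ∏ g
  ∏-scale-one x f g Fin.zero others at-a =
    trans (*-cong at-a (∏.sum-cong-≋ (λ i → others (Fin.suc i) (λ ())))) (*-assoc x _ _)
  ∏-scale-one x f g (Fin.suc a) others at-a =
    trans (*-cong (others Fin.zero (λ ())) (∏-scale-one x (λ i → f (Fin.suc i)) (λ i → g (Fin.suc i)) a
                                              (λ i i≢a → others (Fin.suc i) (λ eq → i≢a (suc-injective eq))) at-a))
          (solve 3 (λ b x p → b :* (x :* p) := x :* (b :* p)) refl (g Fin.zero) x _)

  ∏-≉0 : ∀ {N} (f : Fin N → Carrier) → (∀ i → ¬ f i ≈ 0#) → ¬ ∏ f ≈ 0#
  ∏-≉0 {zero}  f f≉0 = 1≉0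
  ∏-≉0 {suc N} f f≉0 = *-≉0 (f≉0 Fin.zero) (∏-≉0 (λ i → f (Fin.suc i)) (λ i → f≉0 (Fin.suc i)))

  nonzeroOr1 : Carrier → Carrier
  nonzeroOr1 x with x ≟ 0#
  ... | yes _ = 1#
  ... | no  _ = x

  nonzeroOr1-≈0 : ∀ {x} → x ≈ 0# → nonzeroOr1 x ≈ 1#
  nonzeroOr1-≈0 {x} x≈0 with x ≟ 0#
  ... | yes _   = refl
  ... | no  x≉0 = ⊥-elim (x≉0 x≈0)

  nonzeroOr1-≉0 : ∀ {x} → ¬ x ≈ 0# → nonzeroOr1 x ≈ x
  nonzeroOr1-≉0 {x} x≉0 with x ≟ 0#
  ... | yes x≈0 = ⊥-elim (x≉0 x≈0)
  ... | no  _   = refl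

  nonzeroOr1-nonzero : ∀ x → ¬ nonzeroOr1 x ≈ 0#
  nonzeroOr1-nonzero x with x ≟ 0#
  ... | yes _   = 1≉0
  ... | no  x≉0 = x≉0

  nonzeroOr1-cong : ∀ {x y} → x ≈ y → nonzeroOr1 x ≈ nonzeroOr1 y
  nonzeroOr1-cong {x} {y} x≈y = cases (x ≟ 0#)
    where
    cases : Dec (x ≈ 0#) → nonzeroOr1 x ≈ nonzeroOr1 y
    cases (yes x≈0) = trans (nonzeroOr1-≈0 x≈0) (sym (nonzeroOr1-≈0 (trans (sym x≈y) x≈0)))
    cases (no  x≉0) = trans (nonzeroOr1-≉0 x≉0) (trans x≈y (sym (nonzeroOr1-≉0 (λ y≈0 → x≉0 (trans x≈y y≈0)))))

  -- Let P be the product of all nonzero elements (nonzeroOr1 turns the factor 0 into 1).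
  -- Multiplying every factor by x ≉ 0# gives x ^ q * P, but it also permutes the nonzero
  -- factors and turns the factor 1 into x, giving x * P.
  x^q≈x : ∀ x → x ^ q ≈ x
  x^q≈x x with x ≟ 0#
  ... | yes x≈0 = x^q≈0 (card.from 0#)
    where
    x^q≈0 : ∀ {m} → Fin m → x ^ m ≈ x
    x^q≈0 {suc m} _ = trans (*-congʳ x≈0) (trans (zeroˡ _) (sym x≈0))
  ... | no x≉0 = x-y≈0⇒x≈y (*-cancelˡ-≈0 (∏-≉0 g (λ i → nonzeroOr1-nonzero _))
      (trans (solve 3 (λ a b p → p :* (a :- b) := a :* p :- b :* p) refl (x ^ q) x (∏ g)) (x≈y⇒x-y≈0 x^q∏g≈x∏g)))
    where
    open ≈-Reasoning
    g : Fin q → Carrier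
    g i = nonzeroOr1 (card.to i)
    σ τ : Fin q → Fin q
    σ i = card.from (x * card.to i)
    τ i = card.from (x ⁻¹ * card.to i)
    cancel : ∀ {a b} y → a * b ≈ 1# → a * (b * y) ≈ y
    cancel y ab≈1 = trans (sym (*-assoc _ _ y)) (trans (*-congʳ ab≈1) (*-identityˡ y))
    στ : ∀ i → σ (τ i) ≡ i
    στ i = ≡.trans (card.from-cong (trans (*-congˡ (card.strictlyInverseˡ _)) (cancel _ (x*x⁻¹≈1 x≉0))))
                   (card.strictlyInverseʳ i)
    τσ : ∀ i → τ (σ i) ≡ i
    τσ i = ≡.trans (card.from-cong (trans (*-congˡ (card.strictlyInverseˡ _)) (cancel _ (trans (*-comm _ _) (x*x⁻¹≈1 x≉0)))))
                   (card.strictlyInverseʳ i)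
    scaled : ∀ i → i ≢ card.from 0# → x * g i ≈ g (σ i)
    scaled i i≢0 = trans (*-congˡ (nonzeroOr1-≉0 to-i≉0))
                         (sym (trans (nonzeroOr1-cong (card.strictlyInverseˡ _)) (nonzeroOr1-≉0 (*-≉0 x≉0 to-i≉0))))
      where
      to-i≉0 : ¬ card.to i ≈ 0#
      to-i≉0 eq = i≢0 (≡.trans (≡.sym (card.strictlyInverseʳ i)) (card.from-cong eq))
    at-0 : x * g (card.from 0#) ≈ x * g (σ (card.from 0#))
    at-0 = *-congˡ (nonzeroOr1-cong (trans (card.strictlyInverseˡ 0#)
                     (sym (trans (card.strictlyInverseˡ _) (trans (*-congˡ (card.strictlyInverseˡ 0#)) (zeroʳ x))))))
    x^q∏g≈x∏g : x ^ q * ∏ g ≈ x * ∏ g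
    x^q∏g≈x∏g = begin
      x ^ q * ∏ g              ≈⟨ ∏-scale x g ⟨
      ∏ (λ i → x * g i)        ≈⟨ ∏-scale-one x (λ i → x * g i) (λ i → g (σ i)) (card.from 0#) scaled at-0 ⟩
      x * ∏ (λ i → g (σ i))    ≈⟨ *-congˡ (∏.sum-permute g (permutation σ τ στ τσ)) ⟨
      x * ∏ g                  ∎

  2≈0⇒-x≈x : fromℕ 2 ≈ 0# → ∀ x → - x ≈ x
  2≈0⇒-x≈x 2≈0 x = x-y≈0⇒x≈y (combination₁≈0 (solve 1 (λ x → :- x :- x := (:- x) :* con (+ 2)) refl x) 2≈0)

  2≉0⇒x≈-x⇒x≈0 : ¬ fromℕ 2 ≈ 0# → ∀ {x} → x ≈ - x → x ≈ 0#
  2≉0⇒x≈-x⇒x≈0 2≉0 {x} x≈-x = *-cancelˡ-≈0 2≉0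
    (combination₁≈0 (solve 1 (λ x → con (+ 2) :* x := con (+ 1) :* (x :- (:- x))) refl x) (x≈y⇒x-y≈0 x≈-x))

module OsculatingPlanes {q : ℕ} (F : FiniteField q) where
  open FiniteField F hiding (zero)
  open FiniteFieldFacts F
  open IntegerRingSolver F using (solve; _:=_; _:+_; _:*_; _:-_; :-_; con; Polynomial)

  oscForm : Carrier → Carrier → Carrier → Carrier → Carrier → Carrier
  oscForm t x0 x1 x2 x3 = (x0 - fromℕ 3 * t * x1 + fromℕ 3 * (t ^ 2) * x2) - (t ^ 3) * x3

  oscFormₚ : ∀ {n} → Polynomial n → Polynomial n → Polynomial n → Polynomial n → Polynomial n → Polynomial n
  oscFormₚ t x0 x1 x2 x3 =
    (x0 :- con (+ 3) :* t :* x1 :+ con (+ 3) :* (t :* (t :* con (+ 1))) :* x2) :- (t :* (t :* (t :* con (+ 1)))) :* x3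

  oscForm-cong : ∀ {t t′ x0 y0 x1 y1 x2 y2 x3 y3} → t ≈ t′ → x0 ≈ y0 → x1 ≈ y1 → x2 ≈ y2 → x3 ≈ y3 →
                 oscForm t x0 x1 x2 x3 ≈ oscForm t′ y0 y1 y2 y3
  oscForm-cong t≈ e0 e1 e2 e3 =
    +-cong (+-cong (+-cong e0 (-‿cong (*-cong (*-congˡ t≈) e1))) (*-cong (*-congˡ (^-cong 2 t≈)) e2))
           (-‿cong (*-cong (^-cong 3 t≈) e3))

  P₀ : Carrier → Vec4
  P₀ μ = v4 0# μ 0# 1#

  P₁ : Vec4
  P₁ = v4 1# 0# 1# 0#

  P₀-nonzero : ∀ μ → NonZero4 (P₀ μ)
  P₀-nonzero μ (_ , _ , _ , 1≈0) = 1≉0 1≈0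

  P₁-nonzero : NonZero4 P₁
  P₁-nonzero (1≈0 , _) = 1≉0 1≈0

  -- π(t) ⊇ ℓ_μ: P₁ ∈ π(t) reads 1 + 3t² ≈ 0, and given that, P₀ ∈ π(t) reads 3μ + t² ≈ 0.
  OscContainsLine : Carrier → Carrier → Set
  OscContainsLine μ t = OnOsc (just t) P₁ × OnOsc (just t) (P₀ μ)

  onLine : ∀ {μ x0 x1 x2 x3} → x0 ≈ x2 → x1 ≈ μ * x3 → OnLineμ F μ (v4 x0 x1 x2 x3)
  onLine {μ} {x0} {x1} {x2} {x3} x0≈x2 x1≈μx3 =
      x3 , x2
    , trans x0≈x2 (solve 2 (λ x2 x3 → x2 := x3 :* con (+ 0) :+ x2 :* con (+ 1)) refl x2 x3)
    , trans x1≈μx3 (solve 3 (λ μ x2 x3 → μ :* x3 := x3 :* μ :+ x2 :* con (+ 0)) refl μ x2 x3)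
    , solve 2 (λ x2 x3 → x2 := x3 :* con (+ 0) :+ x2 :* con (+ 1)) refl x2 x3
    , solve 2 (λ x2 x3 → x3 := x3 :* con (+ 1) :+ x2 :* con (+ 0)) refl x2 x3

  P₀-onLine : ∀ μ → OnLineμ F μ (P₀ μ)
  P₀-onLine μ = onLine refl (sym (*-identityʳ μ))

  P₁-onLine : ∀ μ → OnLineμ F μ P₁
  P₁-onLine μ = onLine refl (sym (zeroʳ μ))

  P₁∈π⇒Sqrt-3 : ∀ {t} → OnOsc (just t) P₁ → Sqrt-3 (fromℕ 3 * t)
  P₁∈π⇒Sqrt-3 {t} P₁∈π = combination₁≈0
    (solve 1 (λ t → (con (+ 3) :* t) :* (con (+ 3) :* t) :+ con (+ 3)
                    := con (+ 3) :* oscFormₚ t (con (+ 1)) (con (+ 0)) (con (+ 1)) (con (+ 0))) refl t)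
    P₁∈π

  P₁∈π⇒t≉0 : ∀ {t} → OnOsc (just t) P₁ → ¬ t ≈ 0#
  P₁∈π⇒t≉0 {t} P₁∈π t≈0 = 1≉0 (combination₂≈0
    (solve 1 (λ t → con (+ 1) := con (+ 1) :* oscFormₚ t (con (+ 1)) (con (+ 0)) (con (+ 1)) (con (+ 0)) :+ (:- (con (+ 3) :* t)) :* t)
           refl t)
    P₁∈π t≈0)

  P₁∈π⇒t≈±t′ : ¬ fromℕ 3 ≈ 0# → ∀ {t t′} → OnOsc (just t) P₁ → OnOsc (just t′) P₁ → t ≈ t′ ⊎ t ≈ - t′
  P₁∈π⇒t≈±t′ 3≉0 {t} {t′} P₁∈π P₁∈π′ =
    Sum.map x-y≈0⇒x≈y
            (λ t+t′≈0 → x-y≈0⇒x≈y (combination₁≈0 (solve 2 (λ t t′ → t :- (:- t′) := con (+ 1) :* (t :+ t′)) refl t t′) t+t′≈0))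
            (*≈0⇒≈0⊎≈0 (*-cancelˡ-≈0 3≉0 (combination₂≈0
              (solve 2 (λ t t′ → con (+ 3) :* ((t :- t′) :* (t :+ t′))
                                 := con (+ 1) :* oscFormₚ t (con (+ 1)) (con (+ 0)) (con (+ 1)) (con (+ 0))
                                    :+ con -[1+ 0 ] :* oscFormₚ t′ (con (+ 1)) (con (+ 0)) (con (+ 1)) (con (+ 0))) refl t t′)
              P₁∈π P₁∈π′)))

  P₁∈π⇒t≈1 : fromℕ 2 ≈ 0# → ∀ {t} → OnOsc (just t) P₁ → t ≈ 1#
  P₁∈π⇒t≈1 2≈0 {t} P₁∈π = x-y≈0⇒x≈y ([ id , id ]′ (*≈0⇒≈0⊎≈0 (combination₂≈0
    (solve 1 (λ t → (t :- con (+ 1)) :* (t :- con (+ 1))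
                    := con (+ 1) :* oscFormₚ t (con (+ 1)) (con (+ 0)) (con (+ 1)) (con (+ 0)) :+ (:- (t :* t :+ t)) :* con (+ 2)) refl t)
    P₁∈π 2≈0)))

  π⊇ℓ⇒3μ+t²≈0 : ∀ {μ t} → OscContainsLine μ t → fromℕ 3 * μ + t * t ≈ 0#
  π⊇ℓ⇒3μ+t²≈0 {μ} {t} (P₁∈π , P₀∈π) = *-cancelˡ-≈0 (λ -t≈0 → P₁∈π⇒t≉0 P₁∈π (-x≈0⇒x≈0 -t≈0))
    (trans (solve 2 (λ t μ → (:- t) :* (con (+ 3) :* μ :+ t :* t) := oscFormₚ t (con (+ 0)) μ (con (+ 0)) (con (+ 1))) refl t μ)
           P₀∈π)
    where
    -x≈0⇒x≈0 : ∀ {x} → - x ≈ 0# → x ≈ 0#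
    -x≈0⇒x≈0 {x} -x≈0 = combination₁≈0 (solve 1 (λ x → x := con -[1+ 0 ] :* (:- x)) refl x) -x≈0

  π⊇ℓ⇒9μ≈1 : ∀ {μ t} → OscContainsLine μ t → fromℕ 9 * μ ≈ 1#
  π⊇ℓ⇒9μ≈1 {μ} {t} π⊇ℓ@(P₁∈π , _) = x-y≈0⇒x≈y (combination₂≈0
    (solve 2 (λ t μ → con (+ 9) :* μ :- con (+ 1)
                      := con (+ 3) :* (con (+ 3) :* μ :+ t :* t) :+ con -[1+ 0 ] :* oscFormₚ t (con (+ 1)) (con (+ 0)) (con (+ 1)) (con (+ 0)))
           refl t μ)
    (π⊇ℓ⇒3μ+t²≈0 π⊇ℓ) P₁∈π)

  Sqrt-3⇒π⊇ℓ : ∀ {μ y} → fromℕ 9 * μ ≈ 1# → Sqrt-3 y → OscContainsLine μ (fromℕ 3 * μ * y)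
  Sqrt-3⇒π⊇ℓ {μ} {y} 9μ≈1 y²+3≈0 =
      combination₂≈0
        (solve 2 (λ y μ → oscFormₚ (con (+ 3) :* μ :* y) (con (+ 1)) (con (+ 0)) (con (+ 1)) (con (+ 0))
                          := (con (+ 27) :* μ :* μ) :* (y :* y :+ con (+ 3)) :+ (:- (con (+ 1) :+ con (+ 9) :* μ)) :* (con (+ 9) :* μ :- con (+ 1)))
               refl y μ)
        y²+3≈0 (x≈y⇒x-y≈0 9μ≈1)
    , combination₂≈0
        (solve 2 (λ y μ → oscFormₚ (con (+ 3) :* μ :* y) (con (+ 0)) μ (con (+ 0)) (con (+ 1))
                          := (:- (con (+ 27) :* μ :* μ :* μ :* y)) :* (y :* y :+ con (+ 3)) :+ (con (+ 9) :* μ :* μ :* y) :* (con (+ 9) :* μ :- con (+ 1)))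
               refl y μ)
        y²+3≈0 (x≈y⇒x-y≈0 9μ≈1)

  π⊇ℓ-square : ∀ {μ t τ} → OscContainsLine μ t → τ * τ ≈ t * t → OscContainsLine μ τ
  π⊇ℓ-square {μ} {t} {τ} π⊇ℓ@(P₁∈π , _) τ²≈t² =
      combination₂≈0
        (solve 2 (λ t τ → oscFormₚ τ (con (+ 1)) (con (+ 0)) (con (+ 1)) (con (+ 0))
                          := con (+ 1) :* oscFormₚ t (con (+ 1)) (con (+ 0)) (con (+ 1)) (con (+ 0)) :+ con (+ 3) :* (τ :* τ :- t :* t))
               refl t τ)
        P₁∈π (x≈y⇒x-y≈0 τ²≈t²)
    , combination₂≈0
        (solve 3 (λ t τ μ → oscFormₚ τ (con (+ 0)) μ (con (+ 0)) (con (+ 1))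
                            := (:- τ) :* (con (+ 3) :* μ :+ t :* t) :+ (:- τ) :* (τ :* τ :- t :* t))
               refl t τ μ)
        (π⊇ℓ⇒3μ+t²≈0 π⊇ℓ) (x≈y⇒x-y≈0 τ²≈t²)

  π⊇ℓ⇒ℓ⊆π : ∀ {μ t} → OscContainsLine μ t → ∀ x → OnLineμ F μ x → OnOsc (just t) x
  π⊇ℓ⇒ℓ⊆π {μ} {t} (P₁∈π , P₀∈π) (v4 x0 x1 x2 x3) (a , b , e0 , e1 , e2 , e3) =
    trans (oscForm-cong refl e0 e1 e2 e3) (combination₂≈0
      (solve 4 (λ t μ a b → oscFormₚ t (a :* con (+ 0) :+ b :* con (+ 1)) (a :* μ :+ b :* con (+ 0))
                                       (a :* con (+ 0) :+ b :* con (+ 1)) (a :* con (+ 1) :+ b :* con (+ 0))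
                            := b :* oscFormₚ t (con (+ 1)) (con (+ 0)) (con (+ 1)) (con (+ 0))
                               :+ a :* oscFormₚ t (con (+ 0)) μ (con (+ 0)) (con (+ 1)))
             refl t μ a b)
      P₁∈π P₀∈π)

  π⊇ℓ-reduce : ∀ {μ t} → OscContainsLine μ t → ∀ {x0 x1 x2 x3} → OnOsc (just t) (v4 x0 x1 x2 x3) →
               (x0 - x2) - t * (fromℕ 3 * (x1 - μ * x3)) ≈ 0#
  π⊇ℓ-reduce {μ} {t} (P₁∈π , P₀∈π) {x0} {x1} {x2} {x3} x∈π = combination₃≈0
    (solve 6 (λ t μ x0 x1 x2 x3 → (x0 :- x2) :- t :* (con (+ 3) :* (x1 :- μ :* x3))
                                  := con (+ 1) :* oscFormₚ t x0 x1 x2 x3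
                                     :+ (:- x2) :* oscFormₚ t (con (+ 1)) (con (+ 0)) (con (+ 1)) (con (+ 0))
                                     :+ (:- x3) :* oscFormₚ t (con (+ 0)) μ (con (+ 0)) (con (+ 1)))
           refl t μ x0 x1 x2 x3)
    x∈π P₁∈π P₀∈π

  -s²≈s² : ∀ s → - s * - s ≈ s * s
  -s²≈s² s = solve 1 (λ s → (:- s) :* (:- s) := s :* s) refl s

  π⊇ℓ⇒π∩π⁻⊆ℓ : ¬ fromℕ 2 ≈ 0# → ¬ fromℕ 3 ≈ 0# → ∀ {μ s} → OscContainsLine μ s →
               ∀ x → OnOsc (just s) x → OnOsc (just (- s)) x → OnLineμ F μ x
  π⊇ℓ⇒π∩π⁻⊆ℓ 2≉0 3≉0 {μ} {s} π⊇ℓ@(P₁∈π , _) (v4 x0 x1 x2 x3) x∈π x∈π⁻ = onLine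
    (x-y≈0⇒x≈y (*-cancelˡ-≈0 2≉0 (combination₂≈0
      (solve 6 (λ s μ x0 x1 x2 x3 → con (+ 2) :* (x0 :- x2)
                                    := con (+ 1) :* ((x0 :- x2) :- s :* (con (+ 3) :* (x1 :- μ :* x3)))
                                       :+ con (+ 1) :* ((x0 :- x2) :- (:- s) :* (con (+ 3) :* (x1 :- μ :* x3))))
             refl s μ x0 x1 x2 x3)
      R R⁻)))
    (x-y≈0⇒x≈y (*-cancelˡ-≈0 (P₁∈π⇒t≉0 P₁∈π) (*-cancelˡ-≈0 3≉0 (*-cancelˡ-≈0 2≉0 (combination₂≈0
      (solve 6 (λ s μ x0 x1 x2 x3 → con (+ 2) :* (con (+ 3) :* (s :* (x1 :- μ :* x3)))
                                    := con -[1+ 0 ] :* ((x0 :- x2) :- s :* (con (+ 3) :* (x1 :- μ :* x3)))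
                                       :+ con (+ 1) :* ((x0 :- x2) :- (:- s) :* (con (+ 3) :* (x1 :- μ :* x3))))
             refl s μ x0 x1 x2 x3)
      R R⁻)))))
    where
    R : (x0 - x2) - s * (fromℕ 3 * (x1 - μ * x3)) ≈ 0#
    R = π⊇ℓ-reduce π⊇ℓ x∈π
    R⁻ : (x0 - x2) - - s * (fromℕ 3 * (x1 - μ * x3)) ≈ 0#
    R⁻ = π⊇ℓ-reduce (π⊇ℓ-square π⊇ℓ (-s²≈s² s)) x∈π⁻

  Sqrt-3⇒[3μy]²≈-27μ² : ∀ {μ y} → Sqrt-3 y → (fromℕ 3 * μ * y) * (fromℕ 3 * μ * y) ≈ - (fromℕ 27 * μ * μ)
  Sqrt-3⇒[3μy]²≈-27μ² {μ} {y} y²+3≈0 = x-y≈0⇒x≈y (combination₁≈0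
    (solve 2 (λ y μ → (con (+ 3) :* μ :* y) :* (con (+ 3) :* μ :* y) :- (:- (con (+ 27) :* μ :* μ))
                      := (con (+ 9) :* μ :* μ) :* (y :* y :+ con (+ 3))) refl y μ)
    y²+3≈0)

module RealAxes {q : ℕ} (F : FiniteField q) (q%3≢0 : ¬ q % 3 ≡ 0) where
  open FiniteField F hiding (zero)
  open FiniteFieldFacts F
  open OsculatingPlanes F

  3≉0 : ¬ fromℕ 3 ≈ 0#
  3≉0 = q%3≢0⇒3≉0 q%3≢0

  realAxis⇒ : ∀ μ → IsRealAxis F μ → q % 2 ≡ 1 × q % 3 ≡ 1 × fromℕ 9 * μ ≈ 1#
  realAxis⇒ μ (nothing , _ , _ , H) = ⊥-elim (1≉0 (proj₁ (proj₁ (H (P₀ μ) (P₀-nonzero μ)) (P₀-onLine μ))))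
  realAxis⇒ μ (just _ , nothing , _ , H) = ⊥-elim (1≉0 (proj₂ (proj₁ (H (P₀ μ) (P₀-nonzero μ)) (P₀-onLine μ))))
  realAxis⇒ μ (just s , just s′ , s≉s′ , H) =
    2≉0⇒q%2≡1 2≉0 , Sqrt-3⇒q%3≡1 2≉0 3≉0 (P₁∈π⇒Sqrt-3 P₁∈π) , π⊇ℓ⇒9μ≈1 (P₁∈π , P₀∈π)
    where
    P₁∈π : OnOsc (just s) P₁
    P₁∈π = proj₁ (proj₁ (H P₁ P₁-nonzero) (P₁-onLine μ))
    P₁∈π′ : OnOsc (just s′) P₁
    P₁∈π′ = proj₂ (proj₁ (H P₁ P₁-nonzero) (P₁-onLine μ))
    P₀∈π : OnOsc (just s) (P₀ μ)
    P₀∈π = proj₁ (proj₁ (H (P₀ μ) (P₀-nonzero μ)) (P₀-onLine μ))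
    2≉0 : ¬ fromℕ 2 ≈ 0#
    2≉0 2≈0 = [ s≉s′ , (λ s≈-s′ → s≉s′ (trans s≈-s′ (2≈0⇒-x≈x 2≈0 s′))) ]′ (P₁∈π⇒t≈±t′ 3≉0 P₁∈π P₁∈π′)

  ⇒realAxis : ∀ μ → q % 2 ≡ 1 × q % 3 ≡ 1 × fromℕ 9 * μ ≈ 1# → IsRealAxis F μ
  ⇒realAxis μ (q%2≡1 , q%3≡1 , 9μ≈1) =
    just s , just (- s) , s≉-s , λ x _ → (λ x∈ℓ → π⊇ℓ⇒ℓ⊆π π⊇ℓ x x∈ℓ , π⊇ℓ⇒ℓ⊆π π⁻⊇ℓ x x∈ℓ)
                                       , (λ (x∈π , x∈π⁻) → π⊇ℓ⇒π∩π⁻⊆ℓ 2≉0 3≉0 π⊇ℓ x x∈π x∈π⁻)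
    where
    2≉0 : ¬ fromℕ 2 ≈ 0#
    2≉0 = q%2≡1⇒2≉0 q%2≡1
    y s : Carrier
    y = proj₁ (q%3≡1⇒∃Sqrt-3 q%3≡1)
    s = fromℕ 3 * μ * y
    π⊇ℓ : OscContainsLine μ s
    π⊇ℓ = Sqrt-3⇒π⊇ℓ {μ} {y} 9μ≈1 (proj₂ (q%3≡1⇒∃Sqrt-3 q%3≡1))
    π⁻⊇ℓ : OscContainsLine μ (- s)
    π⁻⊇ℓ = π⊇ℓ-square π⊇ℓ (-s²≈s² s)
    s≉-s : ¬ s ≈ - s
    s≉-s s≈-s = P₁∈π⇒t≉0 (proj₁ π⊇ℓ) (2≉0⇒x≈-x⇒x≈0 2≉0 s≈-s)

module Embedding {q : ℕ} {F : FiniteField q} (K : QuadExt F) where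
  open QuadExt K using (E; module F; module E; ι; ι-hom; ι-inj; embed)
  private
    module 𝔽 = OsculatingPlanes F
    module 𝔼 = OsculatingPlanes E
  open IsRingHomomorphism ι-hom

  ι-≈0 : ∀ {a} → ι a E.≈ E.0# → a F.≈ F.0#
  ι-≈0 {a} ιa≈0 = ι-inj a F.0# (E.trans ιa≈0 (E.sym 0#-homo))

  ι-sub : ∀ a b → ι (a F.- b) E.≈ ι a E.- ι b
  ι-sub a b = E.trans (+-homo _ _) (E.+-congˡ (-‿homo _))

  ι-fromℕ : ∀ n → ι (F.fromℕ n) E.≈ E.fromℕ n
  ι-fromℕ zero    = 0#-homo
  ι-fromℕ (suc n) = E.trans (+-homo _ _) (E.+-cong 1#-homo (ι-fromℕ n))

  ι-^ : ∀ a n → ι (a F.^ n) E.≈ ι a E.^ n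
  ι-^ a zero    = 1#-homo
  ι-^ a (suc n) = E.trans (*-homo _ _) (E.*-congˡ (ι-^ a n))

  ι-oscForm : ∀ t x0 x1 x2 x3 → ι (𝔽.oscForm t x0 x1 x2 x3) E.≈ 𝔼.oscForm (ι t) (ι x0) (ι x1) (ι x2) (ι x3)
  ι-oscForm t x0 x1 x2 x3 = E.trans (ι-sub _ _) (E.+-cong
    (E.trans (+-homo _ _) (E.+-cong
      (E.trans (ι-sub _ _) (E.+-congˡ (E.-‿cong (E.trans (*-homo _ _) (E.*-congʳ (E.trans (*-homo _ _) (E.*-congʳ (ι-fromℕ 3))))))))
      (E.trans (*-homo _ _) (E.*-congʳ (E.trans (*-homo _ _) (E.*-cong (ι-fromℕ 3) (ι-^ t 2)))))))
    (E.-‿cong (E.trans (*-homo _ _) (E.*-congʳ (ι-^ t 3)))))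

  ι-OnOsc : ∀ {s} x → F.OnOsc (just s) x → E.OnOsc (just (ι s)) (embed x)
  ι-OnOsc (F.v4 x0 x1 x2 x3) x∈π = E.trans (E.sym (ι-oscForm _ x0 x1 x2 x3)) (E.trans (⟦⟧-cong x∈π) 0#-homo)

  OnOsc-ι : ∀ {s} x → E.OnOsc (just (ι s)) (embed x) → F.OnOsc (just s) x
  OnOsc-ι (F.v4 x0 x1 x2 x3) x∈π = ι-≈0 (E.trans (ι-oscForm _ x0 x1 x2 x3) x∈π)

  embed-P₁ : ∀ {t} → E.OnOsc (just t) (embed 𝔽.P₁) → E.OnOsc (just t) 𝔼.P₁
  embed-P₁ P₁∈π = E.trans (𝔼.oscForm-cong E.refl (E.sym 1#-homo) (E.sym 0#-homo) (E.sym 1#-homo) (E.sym 0#-homo)) P₁∈π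

  embed-P₀ : ∀ {μ t} → E.OnOsc (just t) (embed (𝔽.P₀ μ)) → E.OnOsc (just t) (𝔼.P₀ (ι μ))
  embed-P₀ P₀∈π = E.trans (𝔼.oscForm-cong E.refl (E.sym 0#-homo) E.refl (E.sym 0#-homo) (E.sym 1#-homo)) P₀∈π

  ι-OscContainsLine : ∀ {μ s} → 𝔽.OscContainsLine μ s → 𝔼.OscContainsLine (ι μ) (ι s)
  ι-OscContainsLine (P₁∈π , P₀∈π) = embed-P₁ (ι-OnOsc 𝔽.P₁ P₁∈π) , embed-P₀ (ι-OnOsc (𝔽.P₀ _) P₀∈π)

  OscContainsLine-ι : ∀ {μ s} → 𝔼.OscContainsLine (ι μ) (ι s) → 𝔽.OscContainsLine μ s
  OscContainsLine-ι (P₁∈π , P₀∈π) =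
      OnOsc-ι 𝔽.P₁ (E.trans (𝔼.oscForm-cong E.refl 1#-homo 0#-homo 1#-homo 0#-homo) P₁∈π)
    , OnOsc-ι (𝔽.P₀ _) (E.trans (𝔼.oscForm-cong E.refl 0#-homo E.refl 0#-homo 1#-homo) P₀∈π)

  ι-OnLine : ∀ {μ} x → OnLineμ F μ x → OnLineμ E (ι μ) (embed x)
  ι-OnLine (F.v4 x0 x1 x2 x3) (a , b , e0 , e1 , e2 , e3) =
    ι a , ι b , lift e0 0#-homo 1#-homo , lift e1 E.refl 0#-homo , lift e2 0#-homo 1#-homo , lift e3 1#-homo 0#-homo
    where
    lift : ∀ {x a u b w U W} → x F.≈ a F.* u F.+ b F.* w → ι u E.≈ U → ι w E.≈ W → ι x E.≈ ι a E.* U E.+ ι b E.* W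
    lift eq ιu≈U ιw≈W = E.trans (⟦⟧-cong eq)
      (E.trans (+-homo _ _) (E.+-cong (E.trans (*-homo _ _) (E.*-congˡ ιu≈U)) (E.trans (*-homo _ _) (E.*-congˡ ιw≈W))))

  module _ (3≉0 : ¬ F.fromℕ 3 F.≈ F.0#) where
    open FiniteFieldFacts F using (x-y≈0⇒x≈y; *-cancelˡ-≈0; _⁻¹; x*x⁻¹≈1; _≟_)
    private module 𝔼F = FiniteFieldFacts E

    -- x0 - x2 ≈ t * 3 (x1 - μ x3) has both sides in F, so unless they vanish t lies in F.
    π⊇ℓ⇒π∩PG⊆ℓ : ∀ {μ t} → (∀ s → ¬ ι s E.≈ t) → 𝔼.OscContainsLine (ι μ) t →
                 ∀ x → E.OnOsc (just t) (embed x) → OnLineμ F μ x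
    π⊇ℓ⇒π∩PG⊆ℓ {μ} {t} t∉F π⊇ℓ (F.v4 x0 x1 x2 x3) x∈π = cases (d ≟ F.0#)
      where
      d : F.Carrier
      d = F.fromℕ 3 F.* (x1 F.- μ F.* x3)
      ι[x0-x2]≈t*ιd : ι (x0 F.- x2) E.≈ t E.* ι d
      ι[x0-x2]≈t*ιd = 𝔼F.x-y≈0⇒x≈y (E.trans (E.+-cong (ι-sub x0 x2) (E.-‿cong (E.*-congˡ ιd)))
                                           (𝔼.π⊇ℓ-reduce π⊇ℓ x∈π))
        where
        ιd : ι d E.≈ E.fromℕ 3 E.* (ι x1 E.- ι μ E.* ι x3)
        ιd = E.trans (*-homo _ _) (E.*-cong (ι-fromℕ 3) (E.trans (ι-sub _ _) (E.+-congˡ (E.-‿cong (*-homo _ _)))))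
      cases : Dec (d F.≈ F.0#) → OnLineμ F μ (F.v4 x0 x1 x2 x3)
      cases (yes d≈0) = 𝔽.onLine
        (x-y≈0⇒x≈y (ι-≈0 (E.trans ι[x0-x2]≈t*ιd (E.trans (E.*-congˡ (E.trans (⟦⟧-cong d≈0) 0#-homo)) (E.zeroʳ t)))))
        (x-y≈0⇒x≈y (*-cancelˡ-≈0 3≉0 d≈0))
      cases (no d≉0) = ⊥-elim (t∉F ((x0 F.- x2) F.* d ⁻¹) (E.trans (*-homo _ _)
        (E.trans (E.*-congʳ ι[x0-x2]≈t*ιd) (E.trans (E.*-assoc _ _ _)
          (E.trans (E.*-congˡ (E.trans (E.sym (*-homo _ _)) (E.trans (⟦⟧-cong (x*x⁻¹≈1 d≉0)) 1#-homo))) (E.*-identityʳ t))))))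

module ImaginaryAxes {q : ℕ} {F : FiniteField q} (K : QuadExt F) (q%3≢0 : ¬ q % 3 ≡ 0) where
  open QuadExt K using (E; module F; module E; ι; ι-hom; ι-inj; embed)
  open IsRingHomomorphism ι-hom
  open Embedding K
  open Counting using (n%3≢0,1⇒≡2)
  private
    module 𝔽 = OsculatingPlanes F
    module 𝔼 = OsculatingPlanes E
    module 𝔽F = FiniteFieldFacts F
    module 𝔼F = FiniteFieldFacts E

  3≉0 : ¬ F.fromℕ 3 F.≈ F.0#
  3≉0 = 𝔽F.q%3≢0⇒3≉0 q%3≢0

  ι-fromℕ≉0 : ∀ n → ¬ F.fromℕ n F.≈ F.0# → ¬ E.fromℕ n E.≈ E.0#
  ι-fromℕ≉0 n n≉0 n≈0 = n≉0 (ι-≈0 (E.trans (ι-fromℕ n) n≈0))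

  ι-9μ≈1 : ∀ {μ} → F.fromℕ 9 F.* μ F.≈ F.1# → E.fromℕ 9 E.* ι μ E.≈ E.1#
  ι-9μ≈1 9μ≈1 = E.trans (E.*-congʳ (E.sym (ι-fromℕ 9))) (E.trans (E.sym (*-homo _ _)) (E.trans (⟦⟧-cong 9μ≈1) 1#-homo))

  9ιμ≈1⇒9μ≈1 : ∀ {μ} → E.fromℕ 9 E.* ι μ E.≈ E.1# → F.fromℕ 9 F.* μ F.≈ F.1#
  9ιμ≈1⇒9μ≈1 9ιμ≈1 = ι-inj _ _ (E.trans (*-homo _ _) (E.trans (E.*-congʳ (ι-fromℕ 9)) (E.trans 9ιμ≈1 (E.sym 1#-homo))))

  imaginaryAxis⇒ : ∀ μ → IsImaginaryAxis K μ → q % 2 ≡ 1 × q % 3 ≡ 2 × F.fromℕ 9 F.* μ F.≈ F.1#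
  imaginaryAxis⇒ μ (t , t∉F , H) =
    𝔽F.2≉0⇒q%2≡1 2≉0 , n%3≢0,1⇒≡2 q q%3≢0 q%3≢1 , 9ιμ≈1⇒9μ≈1 (𝔼.π⊇ℓ⇒9μ≈1 π⊇ℓ)
    where
    π⊇ℓ : 𝔼.OscContainsLine (ι μ) t
    π⊇ℓ = embed-P₁ (proj₁ (proj₁ (H 𝔽.P₁ 𝔽.P₁-nonzero) (𝔽.P₁-onLine μ)))
        , embed-P₀ (proj₁ (proj₁ (H (𝔽.P₀ μ) (𝔽.P₀-nonzero μ)) (𝔽.P₀-onLine μ)))
    2≉0 : ¬ F.fromℕ 2 F.≈ F.0#
    2≉0 2≈0 = t∉F F.1# (E.trans 1#-homo (E.sym (𝔼.P₁∈π⇒t≈1 (E.trans (E.sym (ι-fromℕ 2)) (E.trans (⟦⟧-cong 2≈0) 0#-homo)) (proj₁ π⊇ℓ))))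
    -- otherwise some s ∈ F with (3s)² ≈ -3 has π(s) ⊇ ℓ_μ, and t ≈ ± s
    q%3≢1 : q % 3 ≢ 1
    q%3≢1 q%3≡1 = [ (λ t≈ιs → t∉F s (E.sym t≈ιs)) , (λ t≈-ιs → t∉F (F.- s) (E.trans (-‿homo s) (E.sym t≈-ιs))) ]′
                    (𝔼.P₁∈π⇒t≈±t′ (ι-fromℕ≉0 3 3≉0) (proj₁ π⊇ℓ) (proj₁ (ι-OscContainsLine πs⊇ℓ)))
      where
      y s : F.Carrier
      y = proj₁ (𝔽F.q%3≡1⇒∃Sqrt-3 q%3≡1)
      s = F.fromℕ 3 F.* μ F.* y
      πs⊇ℓ : 𝔽.OscContainsLine μ s
      πs⊇ℓ = 𝔽.Sqrt-3⇒π⊇ℓ {μ} {y} (9ιμ≈1⇒9μ≈1 (𝔼.π⊇ℓ⇒9μ≈1 π⊇ℓ)) (proj₂ (𝔽F.q%3≡1⇒∃Sqrt-3 q%3≡1))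

  -- t² = -27 μ² lies in F, hence is fixed by the Frobenius x ↦ x ^ q, so t ^ q ≈ ± t.
  ⇒imaginaryAxis : ∀ μ → q % 2 ≡ 1 × q % 3 ≡ 2 × F.fromℕ 9 F.* μ F.≈ F.1# → IsImaginaryAxis K μ
  ⇒imaginaryAxis μ (q%2≡1 , q%3≡2 , 9μ≈1) =
    t , t∉F , λ x _ → (λ x∈ℓ → 𝔼.π⊇ℓ⇒ℓ⊆π π⊇ℓ (embed x) (ι-OnLine x x∈ℓ) , 𝔼.π⊇ℓ⇒ℓ⊆π πᵠ⊇ℓ (embed x) (ι-OnLine x x∈ℓ))
                    , (λ (x∈π , _) → π⊇ℓ⇒π∩PG⊆ℓ 3≉0 t∉F π⊇ℓ x x∈π)
    where
    q²%3≡1 : (q ℕ.* q) % 3 ≡ 1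
    q²%3≡1 = ≡.trans (%-distribˡ-* q q 3) (≡.cong (λ r → (r ℕ.* r) % 3) q%3≡2)
    y t : E.Carrier
    y = proj₁ (𝔼F.q%3≡1⇒∃Sqrt-3 q²%3≡1)
    t = E.fromℕ 3 E.* ι μ E.* y
    π⊇ℓ : 𝔼.OscContainsLine (ι μ) t
    π⊇ℓ = 𝔼.Sqrt-3⇒π⊇ℓ {ι μ} {y} (ι-9μ≈1 9μ≈1) (proj₂ (𝔼F.q%3≡1⇒∃Sqrt-3 q²%3≡1))
    t∉F : ∀ s → ¬ ι s E.≈ t
    t∉F s ιs≈t = 1≢2 (≡.trans (≡.sym (𝔽F.Sqrt-3⇒q%3≡1 (𝔽F.q%2≡1⇒2≉0 q%2≡1) 3≉0 (𝔽.P₁∈π⇒Sqrt-3 (proj₁ πs⊇ℓ)))) q%3≡2)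
      where
      1≢2 : 1 ≢ 2
      1≢2 ()
      πs⊇ℓ : 𝔽.OscContainsLine μ s
      πs⊇ℓ = OscContainsLine-ι (𝔼.π⊇ℓ-square π⊇ℓ (E.*-cong ιs≈t ιs≈t))
    w : F.Carrier
    w = F.- (F.fromℕ 27 F.* μ F.* μ)
    ιw : ι w E.≈ E.- (E.fromℕ 27 E.* ι μ E.* ι μ)
    ιw = E.trans (-‿homo _) (E.-‿cong (E.trans (*-homo _ _) (E.*-congʳ (E.trans (*-homo _ _) (E.*-congʳ (ι-fromℕ 27))))))
    t²≈ιw : t E.* t E.≈ ι w
    t²≈ιw = E.trans (𝔼.Sqrt-3⇒[3μy]²≈-27μ² {ι μ} {y} (proj₂ (𝔼F.q%3≡1⇒∃Sqrt-3 q²%3≡1))) (E.sym ιw)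
    [tᵠ]²≈t² : (t E.^ q) E.* (t E.^ q) E.≈ t E.* t
    [tᵠ]²≈t² = E.trans (𝔼F.x^n*x^n≈[x*x]^n t q) (E.trans (𝔼F.^-cong q t²≈ιw)
                 (E.trans (E.sym (ι-^ w q)) (E.trans (⟦⟧-cong (𝔽F.x^q≈x w)) (E.sym t²≈ιw))))
    πᵠ⊇ℓ : 𝔼.OscContainsLine (ι μ) (t E.^ q)
    πᵠ⊇ℓ = 𝔼.π⊇ℓ-square π⊇ℓ [tᵠ]²≈t²

lemma4p3 : (q : ℕ) → (F : FiniteField q) → (K : QuadExt F) → ¬ (q % 3 ≡ 0) →
    (μ : FiniteField.Carrier F) →
      (IsImaginaryAxis K μ ⇔ (q % 2 ≡ 1 × q % 3 ≡ 2 × FiniteField._≈_ F (FiniteField._*_ F (FiniteField.fromℕ F 9) μ) (FiniteField.1# F)))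
      × (IsRealAxis F μ ⇔ (q % 2 ≡ 1 × q % 3 ≡ 1 × FiniteField._≈_ F (FiniteField._*_ F (FiniteField.fromℕ F 9) μ) (FiniteField.1# F)))
lemma4p3 q F K q%3≢0 μ =
    mk⇔ (imaginaryAxis⇒ μ) (⇒imaginaryAxis μ)
  , mk⇔ (realAxis⇒ μ) (⇒realAxis μ)
  where
  open ImaginaryAxes K q%3≢0
  open RealAxes F q%3≢0
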